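{- Let $d\ge 1$ be an integer and let $\mathbf e_1,\dots,\mathbf e_{2d+1}$ be the standard basis of $\mathbb R^{2d+1}$. For $i,j\in[d]=\{1,\dots,d\}$ let $\mathbf a_{ij}=\mathbf e_j+\mathbf e_{d+i}+\delta_{ij}\mathbf e_{2d+1}$. Let $K=\{\sum_{i,j}x_{ij}\mathbf a_{ij}: x_{ij}\in\mathbb R_{\ge0}\}$, $Q=\{\sum_{i,j}x_{ij}\mathbf a_{ij}: x_{ij}\in\mathbb Z_{\ge0}\}$, $Q_{\mathrm{sat}}=K\cap\mathbb Z^{2d+1}$ and $H=Q_{\mathrm{sat}}\setminus Q$ (the set of holes). For $k,l\in[d]$ put $\mathbf h_{kl}=\tfrac12(\mathbf a_{ll}+\mathbf a_{lk}+\mathbf a_{kl}+\mathbf a_{kk})$ and $\mathcal F=\{\mathbf h_{kl}: k,l\in[d],\ k<l\}$. Then $\mathcal F$ is exactly the set of fundamental holes of $Q$.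
   Context: A hole $\mathbf h\in H$ is fundamental if there is no other hole $\mathbf h'\in H$, $\mathbf h'\ne\mathbf h$, with $\mathbf h-\mathbf h'\in Q$.
   Formalization: The coefficients $x_{ij}$ defining the cone K are nonnegative rationals rather than nonnegative reals, so $Q_{\mathrm{sat}}$, the holes and the fundamental holes are defined through this rational cone. -}

module Defs where

open import Data.Nat as ℕ using (ℕ; zero; suc)
open import Data.Fin as Fin using (Fin; _↑ˡ_; _↑ʳ_; _≟_)
open import Data.Integer as ℤ using (ℤ; +_)
open import Data.Rational as ℚ using (ℚ; 0ℚ)
open import Data.Product using (Σ; _×_; ∃)
open import Relation.Nullary using (¬_; Dec; yes; no)
open import Relation.Binary.PropositionalEquality using (_≡_)

-- Ambient dimension 2d+1, coordinates indexed by Fin (d + d + 1):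
-- coordinate j (1..d), coordinate d+i (block 2), and the last one 2d+1.
Dim : ℕ → ℕ
Dim d = d ℕ.+ d ℕ.+ 1

Vec : ℕ → Set
Vec d = Fin (Dim d) → ℤ

VecQ : ℕ → Set
VecQ d = Fin (Dim d) → ℚ

colIx : ∀ {d} → Fin d → Fin (Dim d)
colIx {d} j = (j ↑ˡ d) ↑ˡ 1

rowIx : ∀ {d} → Fin d → Fin (Dim d)
rowIx {d} i = (d ↑ʳ i) ↑ˡ 1

lastIx : ∀ {d} → Fin (Dim d)
lastIx {d} = (d ℕ.+ d) ↑ʳ Fin.zero

e : ∀ d → Fin (Dim d) → Vec d
e d p c with p ≟ c
... | yes _ = + 1
... | no _  = + 0

δ : ∀ {d} → Fin d → Fin d → ℤ
δ i j with i ≟ j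
... | yes _ = + 1
... | no _  = + 0

a : ∀ d → Fin d → Fin d → Vec d
a d i j c = e d (colIx j) c ℤ.+ e d (rowIx i) c ℤ.+ δ i j ℤ.* e d (lastIx {d}) c

sumℤ : ∀ {n} → (Fin n → ℤ) → ℤ
sumℤ {zero}  f = + 0
sumℤ {suc n} f = f Fin.zero ℤ.+ sumℤ (λ k → f (Fin.suc k))

sumℚ : ∀ {n} → (Fin n → ℚ) → ℚ
sumℚ {zero}  f = 0ℚ
sumℚ {suc n} f = f Fin.zero ℚ.+ sumℚ (λ k → f (Fin.suc k))

toℚ : ℤ → ℚ
toℚ z = z ℚ./ 1

InQ : ∀ d → Vec d → Set
InQ d v = Σ (Fin d → Fin d → ℕ) λ x →
  ∀ c → v c ≡ sumℤ (λ i → sumℤ (λ j → + (x i j) ℤ.* a d i j c))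

InK : ∀ d → VecQ d → Set
InK d v = Σ (Fin d → Fin d → ℚ) λ x →
  (∀ i j → 0ℚ ℚ.≤ x i j) ×
  (∀ c → v c ≡ sumℚ (λ i → sumℚ (λ j → x i j ℚ.* toℚ (a d i j c))))

InQsat : ∀ d → Vec d → Set
InQsat d v = InK d (λ c → toℚ (v c))

IsHole : ∀ d → Vec d → Set
IsHole d v = InQsat d v × ¬ InQ d v

Eq : ∀ d → Vec d → Vec d → Set
Eq d u v = ∀ c → u c ≡ v c

sub : ∀ d → Vec d → Vec d → Vec d
sub d u v c = u c ℤ.- v c

IsFundamental : ∀ d → Vec d → Set
IsFundamental d h = IsHole d h ×
  ¬ (Σ (Vec d) λ h' → IsHole d h' × ¬ Eq d h' h × InQ d (sub d h h'))

IsHkl : ∀ d → Fin d → Fin d → Vec d → Set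
IsHkl d k l h = ∀ c → + 2 ℤ.* h c ≡ a d l l c ℤ.+ a d l k c ℤ.+ a d k l c ℤ.+ a d k k c

InF : ∀ d → Vec d → Set
InF d h = Σ (Fin d) λ k → Σ (Fin d) λ l → (k Fin.< l) × IsHkl d k l h

{-# OPTIONS --safe #-}
module Submission where

-- Read a vector Σ xᵢⱼ aᵢⱼ of ℤ^(2d+1) as the margins of its coefficient matrix x: column sums,
-- row sums and trace.  Q consists of the margins of ℕ-matrices, and a point of Q_sat, being the
-- margins (c, r, t) of a nonnegative rational matrix, is admissible: Σc = Σr = N,
-- t ≤ Σₘ min (rₘ, cₘ) and rₘ + cₘ ≤ N + t for all m.  Admissible margins of total N > 0 lose
-- one generator aᵢⱼ and stay admissible (aᵢᵢ while t > 0, otherwise i ≠ j), except when t = 1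
-- and two indices k ≠ l carry all of r and c; then removing h_kl leaves admissible margins.  By
-- induction on N every point of Q_sat is in Q or in Q + h_kl for some k ≠ l.  Each h_kl is a
-- hole: ½ (a_kk + a_kl + a_lk + a_ll) lies in K, and an ℕ-matrix with its margins would need
-- x_kk + x_kl = x_kl + x_ll = x_kk + x_ll = 1.  A hole h ∈ h_kl + Q is fundamental only if it
-- is h_kl, and h_kl is fundamental since every hole has total N ≥ 2 = N (h_kl).

open import Defs
open import Data.Nat using (ℕ; _≥_)
open import Function.Bundles using (_⇔_)

open import Algebra.Bundles using (CommutativeMonoid; CommutativeRing; Monoid; Semiring)
import Algebra.Properties.Monoid.Sum
open import Data.Empty using (⊥; ⊥-elim)
open import Data.Fin as Fin using (Fin; zero; suc; punchIn; punchOut; _↑ˡ_; _↑ʳ_; splitAt)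
open import Data.Fin.Properties
  using ( punchIn-punchOut; punchOut-injective; punchInᵢ≢i; punchIn-injective; any?; all?
        ; <-cmp; <⇒≢; splitAt-↑ˡ; splitAt-↑ʳ; splitAt⁻¹-↑ˡ; splitAt⁻¹-↑ʳ)
open import Data.Integer as ℤ using (ℤ)
import Data.Integer.Properties as ℤ
open import Data.Integer.Tactic.RingSolver using (solve-∀)
open import Data.Nat.Base using (zero; suc)
open import Data.Nat.Induction using (<-wellFounded)
import Data.Nat.Properties as ℕ
import Data.Nat.Coprimality as Coprimality
open import Data.Product using (Σ; ∃; _×_; _,_)
open import Data.Rational as ℚ using (ℚ; 0ℚ; ½; mkℚ; *≤*)
import Data.Rational.Properties as ℚ
open import Data.Sum as Sum using (_⊎_; inj₁; inj₂; [_,_]′)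
open import Data.Vec.Functional using (removeAt)
open import Function.Base using (_∘_)
open import Function.Bundles using (mk⇔; Equivalence)
open import Induction.WellFounded using (module All)
open import Level using (0ℓ)
open import Relation.Binary.Bundles using (Preorder)
open import Relation.Binary.Core using (Rel; _Preserves₂_⟶_⟶_)
import Relation.Binary.Construct.On as On
open import Relation.Binary.Definitions using (tri<; tri≈; tri>)
open import Relation.Binary.PropositionalEquality as ≡ using (_≡_; _≢_; _≗_)
open import Relation.Binary.Structures using (IsPreorder)
open import Relation.Nullary using (¬_; yes; no)
open import Relation.Nullary.Decidable using (¬?; _×-dec_; decidable-stable)
open import Relation.Nullary.Negation using (contradiction)
open import Relation.Unary using (Decidable)

module MatrixSum {c ℓ} (M : CommutativeMonoid c ℓ) where

  open CommutativeMonoid M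
  open import Algebra.Properties.CommutativeMonoid.Sum M

  rowSum : ∀ {n} → (Fin n → Fin n → Carrier) → Fin n → Carrier
  rowSum y i = sum (y i)

  colSum : ∀ {n} → (Fin n → Fin n → Carrier) → Fin n → Carrier
  colSum y j = sum (λ i → y i j)

  trace : ∀ {n} → (Fin n → Fin n → Carrier) → Carrier
  trace y = sum (λ i → y i i)

  sum-colSum : ∀ {n} (y : Fin n → Fin n → Carrier) → sum (colSum y) ≈ sum (rowSum y)
  sum-colSum y = sym (∑-comm y)

module SumHomomorphism {a b ℓ₁ ℓ₂} (M : Monoid a ℓ₁) (N : Monoid b ℓ₂)
  (h : Monoid.Carrier M → Monoid.Carrier N)
  (h-ε : Monoid._≈_ N (h (Monoid.ε M)) (Monoid.ε N))
  (h-∙ : ∀ x y → Monoid._≈_ N (h (Monoid._∙_ M x y)) (Monoid._∙_ N (h x) (h y))) where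

  private
    module M = Monoid M
    module N = Monoid N
    module ΣM = Algebra.Properties.Monoid.Sum M
    module ΣN = Algebra.Properties.Monoid.Sum N

  sum-homo : ∀ {n} (f : Fin n → M.Carrier) → h (ΣM.sum f) N.≈ ΣN.sum (h ∘ f)
  sum-homo {zero}  f = h-ε
  sum-homo {suc n} f = N.trans (h-∙ (f zero) _) (N.∙-congˡ (sum-homo (f ∘ suc)))

module OrderedSum {c ℓ₁ ℓ₂} (M : CommutativeMonoid c ℓ₁)
  {_≤_ : Rel (CommutativeMonoid.Carrier M) ℓ₂}
  (≤-isPreorder : IsPreorder (CommutativeMonoid._≈_ M) _≤_)
  (+-mono-≤ : CommutativeMonoid._∙_ M Preserves₂ _≤_ ⟶ _≤_ ⟶ _≤_) where

  open CommutativeMonoid M renaming (_∙_ to _+_; ε to 0#)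
  open import Algebra.Properties.CommutativeMonoid.Sum M
  open import Algebra.Properties.CommutativeSemigroup commutativeSemigroup using (x∙yz≈xz∙y)
  open MatrixSum M
  open IsPreorder ≤-isPreorder using () renaming (refl to ≤-refl)

  ≤-preorder : Preorder c ℓ₁ ℓ₂
  ≤-preorder = record { isPreorder = ≤-isPreorder }

  open import Relation.Binary.Reasoning.Preorder ≤-preorder

  sum-mono-≤ : ∀ {n} {f g : Fin n → Carrier} → (∀ i → f i ≤ g i) → sum f ≤ sum g
  sum-mono-≤ {zero}  _   = ≤-refl
  sum-mono-≤ {suc n} f≤g = +-mono-≤ (f≤g zero) (sum-mono-≤ (f≤g ∘ suc))

  sum-nonneg : ∀ {n} {f : Fin n → Carrier} → (∀ i → 0# ≤ f i) → 0# ≤ sum f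
  sum-nonneg {n} {f} f≥0 = begin
    0#                  ≈⟨ sum-replicate-zero n ⟨
    sum {n} (λ _ → 0#)  ≲⟨ sum-mono-≤ f≥0 ⟩
    sum f               ∎

  single≤sum : ∀ {n} (f : Fin n → Carrier) → (∀ i → 0# ≤ f i) → ∀ m → f m ≤ sum f
  single≤sum {suc n} f f≥0 m = begin
    f m                       ≈⟨ identityʳ (f m) ⟨
    f m + 0#                  ≲⟨ +-mono-≤ ≤-refl (sum-nonneg (f≥0 ∘ punchIn m)) ⟩
    f m + sum (removeAt f m)  ≈⟨ sum-remove f ⟨
    sum f                     ∎

  pair≤sum : ∀ {n} (f : Fin n → Carrier) → (∀ i → 0# ≤ f i) →
             ∀ {m m′} → m ≢ m′ → (f m + f m′) ≤ sum f
  pair≤sum {suc n} f f≥0 {m} {m′} m≢m′ = begin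
    f m + f m′
      ≡⟨ ≡.cong (λ i → f m + f i) (punchIn-punchOut m≢m′) ⟨
    f m + removeAt f m (punchOut m≢m′)
      ≲⟨ +-mono-≤ ≤-refl (single≤sum (removeAt f m) (f≥0 ∘ punchIn m) _) ⟩
    f m + sum (removeAt f m)
      ≈⟨ sum-remove f ⟨
    sum f ∎

  triple≤sum : ∀ {n} (f : Fin n → Carrier) → (∀ i → 0# ≤ f i) →
               ∀ {m₁ m₂ m₃} → m₁ ≢ m₂ → m₁ ≢ m₃ → m₂ ≢ m₃ →
               (f m₁ + (f m₂ + f m₃)) ≤ sum f
  triple≤sum {suc n} f f≥0 {m₁} {m₂} {m₃} m₁≢m₂ m₁≢m₃ m₂≢m₃ = begin
    f m₁ + (f m₂ + f m₃)
      ≡⟨ ≡.cong₂ (λ i j → f m₁ + (f i + f j)) (punchIn-punchOut m₁≢m₂) (punchIn-punchOut m₁≢m₃) ⟨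
    f m₁ + (g (punchOut m₁≢m₂) + g (punchOut m₁≢m₃))
      ≲⟨ +-mono-≤ ≤-refl (pair≤sum g (f≥0 ∘ punchIn m₁)
                                   (m₂≢m₃ ∘ punchOut-injective m₁≢m₂ m₁≢m₃)) ⟩
    f m₁ + sum g
      ≈⟨ sum-remove f ⟨
    sum f ∎
    where
    g : Fin n → Carrier
    g = removeAt f m₁

  rowSum+colSum≤ : ∀ {n} (y : Fin n → Fin n → Carrier) → (∀ i j → 0# ≤ y i j) →
                   ∀ m → (rowSum y m + colSum y m) ≤ (sum (rowSum y) + trace y)
  rowSum+colSum≤ {suc n} y y≥0 m = begin
    rowSum y m + colSum y m
      ≈⟨ ∙-congˡ (sum-remove (λ i → y i m)) ⟩
    rowSum y m + (y m m + sum (removeAt (λ i → y i m) m))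
      ≲⟨ +-mono-≤ ≤-refl (+-mono-≤ ≤-refl
           (sum-mono-≤ (λ i → single≤sum (y (punchIn m i)) (y≥0 _) m))) ⟩
    rowSum y m + (y m m + sum (removeAt (rowSum y) m))
      ≈⟨ x∙yz≈xz∙y (rowSum y m) (y m m) _ ⟩
    rowSum y m + sum (removeAt (rowSum y) m) + y m m
      ≈⟨ ∙-congʳ (sum-remove (rowSum y)) ⟨
    sum (rowSum y) + y m m
      ≲⟨ +-mono-≤ ≤-refl (single≤sum (λ i → y i i) (λ i → y≥0 i i) m) ⟩
    sum (rowSum y) + trace y ∎

module KroneckerSum {c ℓ} (R : Semiring c ℓ) where

  open Semiring R
  open import Algebra.Properties.Semiring.Sum R public
  open MatrixSum +-commutativeMonoid public
  open import Relation.Binary.Reasoning.Setoid setoid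

  𝟙 : ∀ {n} → Fin n → Fin n → Carrier
  𝟙 i j with i Fin.≟ j
  ... | yes _ = 1#
  ... | no  _ = 0#

  𝟙-diag : ∀ {n} (i : Fin n) → 𝟙 i i ≡ 1#
  𝟙-diag i with i Fin.≟ i
  ... | yes _  = ≡.refl
  ... | no i≢i = contradiction ≡.refl i≢i

  𝟙-offdiag : ∀ {n} {i j : Fin n} → i ≢ j → 𝟙 i j ≡ 0#
  𝟙-offdiag {i = i} {j} i≢j with i Fin.≟ j
  ... | yes i≡j = contradiction i≡j i≢j
  ... | no  _   = ≡.refl

  𝟙-sym : ∀ {n} (i j : Fin n) → 𝟙 i j ≡ 𝟙 j i
  𝟙-sym i j with i Fin.≟ j | j Fin.≟ i
  ... | yes _   | yes _   = ≡.refl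
  ... | no  _   | no  _   = ≡.refl
  ... | yes i≡j | no  j≢i = contradiction (≡.sym i≡j) j≢i
  ... | no  i≢j | yes j≡i = contradiction (≡.sym j≡i) i≢j

  sum-single : ∀ {n} (f : Fin n → Carrier) m → (∀ i → i ≢ m → f i ≈ 0#) → sum f ≈ f m
  sum-single {suc n} f m f≈0 = begin
    sum f                     ≈⟨ sum-remove f ⟩
    f m + sum (removeAt f m)  ≈⟨ +-congˡ (sum-cong-≋ (λ i → f≈0 (punchIn m i) (punchInᵢ≢i m i))) ⟩
    f m + sum {n} (λ _ → 0#)  ≈⟨ +-congˡ (sum-replicate-zero n) ⟩
    f m + 0#                  ≈⟨ +-identityʳ (f m) ⟩
    f m                       ∎

  sum-pair : ∀ {n} (f : Fin n → Carrier) {k l} → k ≢ l → (∀ i → i ≢ k → i ≢ l → f i ≈ 0#) →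
             sum f ≈ f k + f l
  sum-pair {suc n} f {k} {l} k≢l f≈0 = begin
    sum f                               ≈⟨ sum-remove f ⟩
    f k + sum (removeAt f k)            ≈⟨ +-congˡ (sum-single (removeAt f k) (punchOut k≢l) elsewhere) ⟩
    f k + f (punchIn k (punchOut k≢l))  ≡⟨ ≡.cong (λ i → f k + f i) (punchIn-punchOut k≢l) ⟩
    f k + f l                           ∎
    where
    elsewhere : ∀ i → i ≢ punchOut k≢l → f (punchIn k i) ≈ 0#
    elsewhere i i≢ = f≈0 (punchIn k i) (punchInᵢ≢i k i)
      (λ eq → i≢ (punchIn-injective k i _ (≡.trans eq (≡.sym (punchIn-punchOut k≢l)))))

  sum-*𝟙 : ∀ {n} (f : Fin n → Carrier) m → sum (λ i → f i * 𝟙 i m) ≈ f m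
  sum-*𝟙 f m = begin
    sum (λ i → f i * 𝟙 i m)  ≈⟨ sum-single _ m (λ i i≢m → trans (*-congˡ (reflexive (𝟙-offdiag i≢m)))
                                                                (zeroʳ (f i))) ⟩
    f m * 𝟙 m m              ≈⟨ *-congˡ (reflexive (𝟙-diag m)) ⟩
    f m * 1#                 ≈⟨ *-identityʳ (f m) ⟩
    f m                      ∎

  sum-*𝟙ᵀ : ∀ {n} (f : Fin n → Carrier) m → sum (λ i → f i * 𝟙 m i) ≈ f m
  sum-*𝟙ᵀ f m = trans (sum-cong-≋ (λ i → *-congˡ (reflexive (𝟙-sym m i)))) (sum-*𝟙 f m)

  sum-*𝟙-pair : ∀ {n} (f : Fin n → Carrier) k l → sum (λ j → f j * (𝟙 j k + 𝟙 j l)) ≈ f k + f l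
  sum-*𝟙-pair f k l = begin
    sum (λ j → f j * (𝟙 j k + 𝟙 j l))
      ≈⟨ sum-cong-≋ (λ j → distribˡ (f j) (𝟙 j k) (𝟙 j l)) ⟩
    sum (λ j → f j * 𝟙 j k + f j * 𝟙 j l)
      ≈⟨ ∑-distrib-+ (λ j → f j * 𝟙 j k) (λ j → f j * 𝟙 j l) ⟩
    sum (λ j → f j * 𝟙 j k) + sum (λ j → f j * 𝟙 j l)
      ≈⟨ +-cong (sum-*𝟙 f k) (sum-*𝟙 f l) ⟩
    f k + f l ∎

  sum-𝟙 : ∀ {n} (m : Fin n) → sum (𝟙 m) ≈ 1#
  sum-𝟙 m = trans (sum-cong-≋ (λ i → sym (*-identityˡ (𝟙 m i)))) (sum-*𝟙ᵀ (λ _ → 1#) m)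

  sifted-rowSum : ∀ {n} (y : Fin n → Fin n → Carrier) m →
                  sum (λ i → sum (λ j → y i j * 𝟙 i m)) ≈ rowSum y m
  sifted-rowSum y m = begin
    sum (λ i → sum (λ j → y i j * 𝟙 i m))  ≈⟨ sum-cong-≋ (λ i → sym (*-distribʳ-sum (𝟙 i m) (y i))) ⟩
    sum (λ i → rowSum y i * 𝟙 i m)         ≈⟨ sum-*𝟙 (rowSum y) m ⟩
    rowSum y m                             ∎

  sifted-colSum : ∀ {n} (y : Fin n → Fin n → Carrier) m →
                  sum (λ i → sum (λ j → y i j * 𝟙 j m)) ≈ colSum y m
  sifted-colSum y m = sum-cong-≋ (λ i → sum-*𝟙 (y i) m)

  sifted-trace : ∀ {n} (y : Fin n → Fin n → Carrier) →
                 sum (λ i → sum (λ j → y i j * 𝟙 i j)) ≈ trace y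
  sifted-trace y = sum-cong-≋ (λ i → sum-*𝟙ᵀ (y i) i)

-- Margins of ℕ-matrices

open ≡ using (refl; sym; trans; cong; cong₂; subst; subst₂)
open import Data.Nat.Base using (_+_; _*_; _∸_; _≤_; _<_; _⊓_; z≤n; s≤s)
open import Algebra.Properties.CommutativeSemigroup ℕ.+-commutativeSemigroup
  using (interchange; x∙yz≈y∙xz; xy∙z≈xz∙y)

open KroneckerSum ℕ.+-*-semiring
open OrderedSum (Semiring.+-commutativeMonoid ℕ.+-*-semiring) ℕ.≤-isPreorder ℕ.+-mono-≤

data NoneUniqueOrPair {n} (P : Fin n → Set) : Set where
  none   : (∀ m → ¬ P m) → NoneUniqueOrPair P
  unique : ∀ m → P m → (∀ m′ → m′ ≢ m → ¬ P m′) → NoneUniqueOrPair P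
  pair   : ∀ {m m′} → m ≢ m′ → P m → P m′ → NoneUniqueOrPair P

noneUniqueOrPair : ∀ {n} {P : Fin n → Set} → Decidable P → NoneUniqueOrPair P
noneUniqueOrPair P? with any? P?
... | no ∄P = none (λ m Pm → ∄P (m , Pm))
... | yes (m , Pm) with any? (λ m′ → ¬? (m′ Fin.≟ m) ×-dec P? m′)
...   | no ∄P′                = unique m Pm (λ m′ m′≢m Pm′ → ∄P′ (m′ , m′≢m , Pm′))
...   | yes (m′ , m′≢m , Pm′) = pair (m′≢m ∘ sym) Pm Pm′

1≰n⇒n≡0 : ∀ {n} → ¬ 1 ≤ n → n ≡ 0
1≰n⇒n≡0 = ℕ.n<1⇒n≡0 ∘ ℕ.≰⇒>

positive-entry : ∀ {n} (f : Fin n → ℕ) → 1 ≤ sum f → ∃ λ i → 1 ≤ f i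
positive-entry {n} f 1≤∑f with any? (λ i → 1 ℕ.≤? f i)
... | yes found = found
... | no  ∄     = contradiction (subst (1 ≤_) ∑f≡0 1≤∑f) λ ()
  where
  ∑f≡0 : sum f ≡ 0
  ∑f≡0 = trans (sum-cong-≗ (λ i → 1≰n⇒n≡0 (λ 1≤fᵢ → ∄ (i , 1≤fᵢ)))) (sum-replicate-zero n)

other-positive-entry : ∀ {n} (f : Fin n → ℕ) a → f a < sum f → ∃ λ i → i ≢ a × 1 ≤ f i
other-positive-entry f a fₐ<∑f with any? (λ i → ¬? (i Fin.≟ a) ×-dec (1 ℕ.≤? f i))
... | yes found = found
... | no  ∄     = contradiction (subst (f a <_) ∑f≡fₐ fₐ<∑f) (ℕ.<-irrefl refl)
  where
  ∑f≡fₐ : sum f ≡ f a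
  ∑f≡fₐ = sum-single f a (λ i i≢a → 1≰n⇒n≡0 (λ 1≤fᵢ → ∄ (i , i≢a , 1≤fᵢ)))

heavy⇒other≤ : ∀ {n} (f g : Fin n → ℕ) {p m} → p ≢ m → sum g ≤ f m + g m → g p ≤ f m
heavy⇒other≤ f g {p} {m} p≢m ∑g≤ =
  ℕ.+-cancelʳ-≤ (g m) (g p) (f m) (ℕ.≤-trans (pair≤sum g (λ _ → z≤n) p≢m) ∑g≤)

𝟙≤ : ∀ {n} {f : Fin n → ℕ} {i} → 1 ≤ f i → ∀ m → 𝟙 i m ≤ f m
𝟙≤ {i = i} 1≤fᵢ m with i Fin.≟ m
... | yes refl = 1≤fᵢ
... | no  _    = z≤n

𝟙+𝟙≤ : ∀ {n} {f : Fin n → ℕ} {k l} → k ≢ l → 1 ≤ f k → 1 ≤ f l →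
       ∀ m → 𝟙 k m + 𝟙 l m ≤ f m
𝟙+𝟙≤ {k = k} {l} k≢l 1≤fₖ 1≤fₗ m with k Fin.≟ m | l Fin.≟ m
... | yes refl | yes refl = contradiction refl k≢l
... | yes refl | no  _    = 1≤fₖ
... | no  _    | yes refl = 1≤fₗ
... | no  _    | no  _    = z≤n

no-odd-triangle : ∀ p q r → p + q ≡ 1 → q + r ≡ 1 → p + r ≡ 1 → ⊥
no-odd-triangle zero          .1 .1 refl () refl
no-odd-triangle (suc zero)    .0 .0 refl () refl
no-odd-triangle (suc (suc p)) q  r  ()   _  _

Matrix : ℕ → Set
Matrix d = Fin d → Fin d → ℕ

record Margins (d : ℕ) : Set where
  constructor ⟨_,_,_⟩
  field
    rows cols : Fin d → ℕ
    diag      : ℕ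
open Margins

private variable
  d : ℕ
  i j k l k′ l′ m m₁ m₂ p : Fin d
  μ ν κ : Margins d

infixl 6 _⊕_ _⊖_
infix 4 _≋_ _≼_

_⊕_ : Margins d → Margins d → Margins d
μ ⊕ ν = ⟨ (λ m → rows μ m + rows ν m) , (λ m → cols μ m + cols ν m) , diag μ + diag ν ⟩

_⊖_ : Margins d → Margins d → Margins d
μ ⊖ ν = ⟨ (λ m → rows μ m ∸ rows ν m) , (λ m → cols μ m ∸ cols ν m) , diag μ ∸ diag ν ⟩

𝟘 : Margins d
𝟘 = ⟨ (λ _ → 0) , (λ _ → 0) , 0 ⟩

-- The margins of a_ij and of h_kl.
unit : Fin d → Fin d → Margins d
unit i j = ⟨ 𝟙 i , 𝟙 j , 𝟙 i j ⟩

hole : Fin d → Fin d → Margins d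
hole k l = ⟨ (λ m → 𝟙 k m + 𝟙 l m) , (λ m → 𝟙 k m + 𝟙 l m) , 1 ⟩

marginsOf : Matrix d → Margins d
marginsOf x = ⟨ rowSum x , colSum x , trace x ⟩

record _≋_ (μ ν : Margins d) : Set where
  field
    rows-≡ : ∀ m → rows μ m ≡ rows ν m
    cols-≡ : ∀ m → cols μ m ≡ cols ν m
    diag-≡ : diag μ ≡ diag ν
open _≋_

≋-refl : μ ≋ μ
≋-refl = record { rows-≡ = λ _ → refl ; cols-≡ = λ _ → refl ; diag-≡ = refl }

≋-trans : μ ≋ ν → ν ≋ κ → μ ≋ κ
≋-trans μ≋ν ν≋κ = record
  { rows-≡ = λ m → trans (rows-≡ μ≋ν m) (rows-≡ ν≋κ m)
  ; cols-≡ = λ m → trans (cols-≡ μ≋ν m) (cols-≡ ν≋κ m)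
  ; diag-≡ = trans (diag-≡ μ≋ν) (diag-≡ ν≋κ)
  }

⊕-𝟘 : (μ : Margins d) → μ ⊕ 𝟘 ≋ μ
⊕-𝟘 μ = record
  { rows-≡ = λ m → ℕ.+-identityʳ (rows μ m)
  ; cols-≡ = λ m → ℕ.+-identityʳ (cols μ m)
  ; diag-≡ = ℕ.+-identityʳ (diag μ)
  }

hole-sym : (k l : Fin d) → hole k l ≋ hole l k
hole-sym k l = record
  { rows-≡ = λ m → ℕ.+-comm (𝟙 k m) (𝟙 l m)
  ; cols-≡ = λ m → ℕ.+-comm (𝟙 k m) (𝟙 l m)
  ; diag-≡ = refl
  }

record _≼_ (μ ν : Margins d) : Set where
  field
    rows-≤ : ∀ m → rows μ m ≤ rows ν m
    cols-≤ : ∀ m → cols μ m ≤ cols ν m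
    diag-≤ : diag μ ≤ diag ν

⊖-⊕ : κ ≼ μ → μ ≋ μ ⊖ κ ⊕ κ
⊖-⊕ κ≼μ = record
  { rows-≡ = λ m → sym (ℕ.m∸n+n≡m (rows-≤ m))
  ; cols-≡ = λ m → sym (ℕ.m∸n+n≡m (cols-≤ m))
  ; diag-≡ = sym (ℕ.m∸n+n≡m diag-≤)
  }
  where open _≼_ κ≼μ

total : Margins d → ℕ
total μ = sum (rows μ)

load : Margins d → Fin d → ℕ
load μ m = rows μ m + cols μ m

capacity : Margins d → ℕ
capacity μ = total μ + diag μ

total-⊕ : μ ≋ ν ⊕ κ → total μ ≡ total ν + total κ
total-⊕ {ν = ν} {κ} μ≋ = trans (sum-cong-≗ (rows-≡ μ≋)) (∑-distrib-+ (rows ν) (rows κ))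

capacity-⊕ : μ ≋ ν ⊕ κ → capacity μ ≡ capacity ν + capacity κ
capacity-⊕ {ν = ν} {κ} μ≋ = trans (cong₂ _+_ (total-⊕ {ν = ν} {κ} μ≋) (diag-≡ μ≋))
                                  (interchange (total ν) (total κ) (diag ν) (diag κ))

load-⊕ : μ ≋ ν ⊕ κ → ∀ m → load μ m ≡ load ν m + load κ m
load-⊕ {ν = ν} {κ} μ≋ m = trans (cong₂ _+_ (rows-≡ μ≋ m) (cols-≡ μ≋ m))
                                (interchange (rows ν m) (rows κ m) (cols ν m) (cols κ m))

total-unit : (i j : Fin d) → total (unit i j) ≡ 1
total-unit i j = sum-𝟙 i

capacity-unit : (i j : Fin d) → capacity (unit i j) ≡ 1 + 𝟙 i j
capacity-unit i j = cong (_+ 𝟙 i j) (sum-𝟙 i)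

total-hole : (k l : Fin d) → total (hole k l) ≡ 2
total-hole k l = trans (∑-distrib-+ (𝟙 k) (𝟙 l)) (cong₂ _+_ (sum-𝟙 k) (sum-𝟙 l))

capacity-hole : (k l : Fin d) → capacity (hole k l) ≡ 3
capacity-hole k l = cong (_+ 1) (total-hole k l)

total-decreases : μ ≋ ν ⊕ κ → 1 ≤ total κ → total ν < total μ
total-decreases {ν = ν} {κ} μ≋ 1≤κ =
  subst (total ν <_) (sym (total-⊕ {ν = ν} {κ} μ≋)) (ℕ.m<m+n (total ν) 1≤κ)

record Admissible (μ : Margins d) : Set where
  field
    balanced   : sum (cols μ) ≡ total μ
    diag-bound : diag μ ≤ sum (λ m → rows μ m ⊓ cols μ m)
    load-bound : ∀ m → load μ m ≤ capacity μ
open Admissible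

data Base {d} : Margins d → Set where
  no-hole  : Base 𝟘
  one-hole : k ≢ l → Base (hole k l)

record Decomposition (μ : Margins d) : Set where
  constructor decomposition
  field
    base   : Margins d
    isBase : Base base
    matrix : Matrix d
    splits : μ ≋ marginsOf matrix ⊕ base
open Decomposition

addUnit : Fin d → Fin d → Matrix d → Matrix d
addUnit i j x p q = x p q + 𝟙 i p * 𝟙 j q

marginsOf-addUnit : ∀ (i j : Fin d) x → marginsOf (addUnit i j x) ≋ marginsOf x ⊕ unit i j
marginsOf-addUnit i j x = record
  { rows-≡ = λ p → trans (∑-distrib-+ (x p) _) (cong (rowSum x p +_) (on-row p))
  ; cols-≡ = λ q → trans (∑-distrib-+ (λ p → x p q) _) (cong (colSum x q +_) (on-col q))
  ; diag-≡ = trans (∑-distrib-+ (λ p → x p p) _) (cong (trace x +_) (sum-*𝟙ᵀ (𝟙 i) j))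
  }
  where
  on-row : ∀ p → sum (λ q → 𝟙 i p * 𝟙 j q) ≡ 𝟙 i p
  on-row p = trans (sym (*-distribˡ-sum (𝟙 i p) (𝟙 j)))
                   (trans (cong (𝟙 i p *_) (sum-𝟙 j)) (ℕ.*-identityʳ (𝟙 i p)))
  on-col : ∀ q → sum (λ p → 𝟙 i p * 𝟙 j q) ≡ 𝟙 j q
  on-col q = trans (sym (*-distribʳ-sum (𝟙 j q) (𝟙 i)))
                   (trans (cong (_* 𝟙 j q) (sum-𝟙 i)) (ℕ.*-identityˡ (𝟙 j q)))

decomposition-⊕-unit : μ ≋ ν ⊕ unit i j → Decomposition ν → Decomposition μ
decomposition-⊕-unit {i = i} {j} μ≋ D = record
  { base   = base D
  ; isBase = isBase D
  ; matrix = addUnit i j (matrix D)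
  ; splits = record
    { rows-≡ = λ m → shift (rows-≡ μ≋ m) (rows-≡ (splits D) m) (rows-≡ added m)
    ; cols-≡ = λ m → shift (cols-≡ μ≋ m) (cols-≡ (splits D) m) (cols-≡ added m)
    ; diag-≡ = shift (diag-≡ μ≋) (diag-≡ (splits D)) (diag-≡ added)
    }
  }
  where
  added : marginsOf (addUnit i j (matrix D)) ≋ marginsOf (matrix D) ⊕ unit i j
  added = marginsOf-addUnit i j (matrix D)
  shift : ∀ {a b c e f g} → a ≡ b + c → b ≡ e + f → g ≡ e + c → a ≡ g + f
  shift {c = c} {e} {f} a≡ b≡ g≡ =
    trans a≡ (trans (cong (_+ c) b≡) (trans (xy∙z≈xz∙y e f c) (cong (_+ f) (sym g≡))))

decomposition-⊕-hole : k ≢ l → μ ≋ ν ⊕ hole k l → diag ν ≡ 0 → Decomposition ν → Decomposition μ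
decomposition-⊕-hole k≢l μ≋ t≡0 (decomposition _ no-hole x ν≋) =
  decomposition _ (one-hole k≢l) x (record
    { rows-≡ = λ m → trans (rows-≡ μ≋ m) (cong (_+ _) (trans (rows-≡ ν≋ m) (ℕ.+-identityʳ _)))
    ; cols-≡ = λ m → trans (cols-≡ μ≋ m) (cong (_+ _) (trans (cols-≡ ν≋ m) (ℕ.+-identityʳ _)))
    ; diag-≡ = trans (diag-≡ μ≋) (cong (_+ 1) (trans (diag-≡ ν≋) (ℕ.+-identityʳ _)))
    })
decomposition-⊕-hole k≢l μ≋ t≡0 (decomposition _ (one-hole _) x ν≋) =
  contradiction (trans (ℕ.+-comm 1 (trace x)) (trans (sym (diag-≡ ν≋)) t≡0)) ℕ.1+n≢0

empty-decomposition : ∀ {d} {μ : Margins d} → Admissible μ → total μ ≡ 0 → Decomposition μ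
empty-decomposition {d} {μ} adm N≡0 = record
  { base   = 𝟘
  ; isBase = no-hole
  ; matrix = λ _ _ → 0
  ; splits = record
    { rows-≡ = λ m → trans (rows≡0 m) zero-margin
    ; cols-≡ = λ m → trans (cols≡0 m) zero-margin
    ; diag-≡ = trans diag≡0 zero-margin
    }
  }
  where
  zero-margin : 0 ≡ sum {d} (λ _ → 0) + 0
  zero-margin = sym (trans (ℕ.+-identityʳ _) (sum-replicate-zero d))
  rows≡0 : ∀ m → rows μ m ≡ 0
  rows≡0 m = ℕ.n≤0⇒n≡0 (subst (rows μ m ≤_) N≡0 (single≤sum (rows μ) (λ _ → z≤n) m))
  cols≡0 : ∀ m → cols μ m ≡ 0
  cols≡0 m = ℕ.n≤0⇒n≡0 (subst (cols μ m ≤_) (trans (balanced adm) N≡0)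
                               (single≤sum (cols μ) (λ _ → z≤n) m))
  diag≡0 : diag μ ≡ 0
  diag≡0 = ℕ.n≤0⇒n≡0 (subst (diag μ ≤_) N≡0
             (ℕ.≤-trans (diag-bound adm) (sum-mono-≤ (λ m → ℕ.m⊓n≤m (rows μ m) (cols μ m)))))

marginsOf-empty : (x : Matrix d) → total (marginsOf x) ≡ 0 → marginsOf x ≋ 𝟘
marginsOf-empty {d} x N≡0 = record
  { rows-≡ = λ i → vanishing (x i) (λ j → entry≡0 i j)
  ; cols-≡ = λ j → vanishing (λ i → x i j) (λ i → entry≡0 i j)
  ; diag-≡ = vanishing (λ i → x i i) (λ i → entry≡0 i i)
  }
  where
  vanishing : (f : Fin d → ℕ) → (∀ i → f i ≡ 0) → sum f ≡ 0
  vanishing f f≡0 = trans (sum-cong-≗ f≡0) (sum-replicate-zero d)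
  entry≡0 : ∀ i j → x i j ≡ 0
  entry≡0 i j = ℕ.n≤0⇒n≡0 (subst (x i j ≤_) N≡0
    (ℕ.≤-trans (single≤sum (x i) (λ _ → z≤n) j) (single≤sum (rowSum x) (λ _ → z≤n) i)))

hole-minimal : (x : Matrix d) → hole k l ≋ marginsOf x ⊕ (μ ⊕ hole k′ l′) → marginsOf x ≋ 𝟘
hole-minimal {k = k} {l} {μ = μ} {k′} {l′} x hole≋ =
  marginsOf-empty x (ℕ.m+n≡0⇒m≡0 _ (ℕ.+-cancelʳ-≡ 2 _ 0 (begin
    total (marginsOf x) + total μ + 2                     ≡⟨ ℕ.+-assoc (total (marginsOf x)) (total μ) 2 ⟩
    total (marginsOf x) + (total μ + 2)                   ≡⟨ cong (λ t → total (marginsOf x) + (total μ + t))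
                                                                  (total-hole k′ l′) ⟨
    total (marginsOf x) + (total μ + total (hole k′ l′))  ≡⟨ cong (total (marginsOf x) +_)
                                                                  (total-⊕ {ν = μ} {hole k′ l′} ≋-refl) ⟨
    total (marginsOf x) + total (μ ⊕ hole k′ l′)          ≡⟨ total-⊕ {ν = marginsOf x} {μ ⊕ hole k′ l′}
                                                                     hole≋ ⟨
    total (hole k l)                                      ≡⟨ total-hole k l ⟩
    2                                                     ∎)))
  where open ≡.≡-Reasoning

hole-unrealizable : k ≢ l → (x : Matrix d) → ¬ marginsOf x ≋ hole k l
hole-unrealizable {k = k} {l} k≢l x x≋ = no-odd-triangle (x k k) (x k l) (x l l) row-k col-l diagonal
  where
  vanish : ∀ {e s} → e ≤ s → s ≡ 0 → e ≡ 0
  vanish e≤s s≡0 = ℕ.n≤0⇒n≡0 (subst (_ ≤_) s≡0 e≤s)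
  outside : ∀ {s i} → s ≡ 𝟙 k i + 𝟙 l i → i ≢ k → i ≢ l → s ≡ 0
  outside s≡ i≢k i≢l = trans s≡ (cong₂ _+_ (𝟙-offdiag (i≢k ∘ sym)) (𝟙-offdiag (i≢l ∘ sym)))
  row-vanishes : ∀ i j → i ≢ k → i ≢ l → x i j ≡ 0
  row-vanishes i j i≢k i≢l = vanish (single≤sum (x i) (λ _ → z≤n) j) (outside (rows-≡ x≋ i) i≢k i≢l)
  col-vanishes : ∀ i j → j ≢ k → j ≢ l → x i j ≡ 0
  col-vanishes i j j≢k j≢l =
    vanish (single≤sum (λ i → x i j) (λ _ → z≤n) i) (outside (cols-≡ x≋ j) j≢k j≢l)
  row-k : x k k + x k l ≡ 1
  row-k = trans (sym (sum-pair (x k) k≢l (col-vanishes k)))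
                (trans (rows-≡ x≋ k) (cong₂ _+_ (𝟙-diag k) (𝟙-offdiag (k≢l ∘ sym))))
  col-l : x k l + x l l ≡ 1
  col-l = trans (sym (sum-pair (λ i → x i l) k≢l (λ i → row-vanishes i l)))
                (trans (cols-≡ x≋ l) (cong₂ _+_ (𝟙-offdiag k≢l) (𝟙-diag l)))
  diagonal : x k k + x l l ≡ 1
  diagonal = trans (sym (sum-pair (λ i → x i i) k≢l (λ i → row-vanishes i i))) (diag-≡ x≋)

-- Peeling off a generator

-- Removing κ from μ keeps the load bound at m when the room s that κ leaves at m is free in μ.
Room : Margins d → Margins d → Fin d → Set
Room κ μ m = Σ ℕ λ s → s + load κ m ≡ capacity κ × s + load μ m ≤ capacity μ

admissible-⊖ : μ ≋ ν ⊕ κ → Admissible μ → sum (cols κ) ≡ total κ →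
               diag ν ≤ sum (λ m → rows ν m ⊓ cols ν m) → (∀ m → Room κ μ m) → Admissible ν
admissible-⊖ {μ = μ} {ν} {κ} μ≋ adm κ-balanced ν-diag room = record
  { balanced   = ℕ.+-cancelʳ-≡ (total κ) _ _ ν-balanced
  ; diag-bound = ν-diag
  ; load-bound = λ m → ν-load m (room m)
  }
  where
  open ℕ.≤-Reasoning
  ν-balanced : sum (cols ν) + total κ ≡ total ν + total κ
  ν-balanced = begin-equality
    sum (cols ν) + total κ           ≡⟨ cong (sum (cols ν) +_) κ-balanced ⟨
    sum (cols ν) + sum (cols κ)      ≡⟨ ∑-distrib-+ (cols ν) (cols κ) ⟨
    sum (λ m → cols ν m + cols κ m)  ≡⟨ sum-cong-≗ (cols-≡ μ≋) ⟨
    sum (cols μ)                     ≡⟨ balanced adm ⟩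
    total μ                          ≡⟨ total-⊕ {ν = ν} {κ} μ≋ ⟩
    total ν + total κ                ∎
  ν-load : ∀ m → Room κ μ m → load ν m ≤ capacity ν
  ν-load m (s , s+κ≡ , s+μ≤) = ℕ.+-cancelʳ-≤ (capacity κ) (load ν m) (capacity ν) (begin
    load ν m + capacity κ      ≡⟨ cong (load ν m +_) s+κ≡ ⟨
    load ν m + (s + load κ m)  ≡⟨ x∙yz≈y∙xz (load ν m) s (load κ m) ⟩
    s + (load ν m + load κ m)  ≡⟨ cong (s +_) (load-⊕ {ν = ν} {κ} μ≋ m) ⟨
    s + load μ m               ≤⟨ s+μ≤ ⟩
    capacity μ                 ≡⟨ capacity-⊕ {ν = ν} {κ} μ≋ ⟩
    capacity ν + capacity κ    ∎)

data Peeling (μ : Margins d) : Set where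
  peel-unit : ∀ i j {ν} → μ ≋ ν ⊕ unit i j → Admissible ν → Peeling μ
  peel-hole : ∀ {k l ν} → k ≢ l → μ ≋ ν ⊕ hole k l → Admissible ν → diag ν ≡ 0 → Peeling μ

diagonal-peeling : ∀ {d} {μ : Margins d} {p} → Admissible μ → 1 ≤ rows μ p → 1 ≤ cols μ p → 1 ≤ diag μ →
                   (∀ m → m ≢ p → 2 + load μ m ≤ capacity μ) → Peeling μ
diagonal-peeling {d} {μ} {p} adm 1≤rₚ 1≤cₚ 1≤t roomy =
  peel-unit p p split (admissible-⊖ split adm refl rest-diag room)
  where
  open ℕ.≤-Reasoning
  rest : Margins d
  rest = μ ⊖ unit p p
  split : μ ≋ rest ⊕ unit p p
  split = ⊖-⊕ (record { rows-≤ = 𝟙≤ 1≤rₚ ; cols-≤ = 𝟙≤ 1≤cₚ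
                      ; diag-≤ = subst (_≤ diag μ) (sym (𝟙-diag p)) 1≤t })
  min-rest : ℕ
  min-rest = sum (λ m → rows rest m ⊓ cols rest m)
  rest-diag : diag rest ≤ min-rest
  rest-diag = ℕ.+-cancelʳ-≤ 1 _ _ (begin
    diag rest + 1                                  ≡⟨ cong (diag rest +_) (𝟙-diag p) ⟨
    diag rest + 𝟙 p p                              ≡⟨ diag-≡ split ⟨
    diag μ                                         ≤⟨ diag-bound adm ⟩
    sum (λ m → rows μ m ⊓ cols μ m)                ≡⟨ sum-cong-≗ min-split ⟩
    sum (λ m → rows rest m ⊓ cols rest m + 𝟙 p m)  ≡⟨ ∑-distrib-+ _ (𝟙 p) ⟩
    min-rest + sum (𝟙 p)                           ≡⟨ cong (min-rest +_) (sum-𝟙 p) ⟩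
    min-rest + 1                                   ∎)
    where
    min-split : ∀ m → rows μ m ⊓ cols μ m ≡ rows rest m ⊓ cols rest m + 𝟙 p m
    min-split m = trans (cong₂ _⊓_ (rows-≡ split m) (cols-≡ split m))
                        (sym (ℕ.+-distribʳ-⊓ (𝟙 p m) (rows rest m) (cols rest m)))
  room : ∀ m → Room (unit p p) μ m
  room m with m Fin.≟ p
  ... | yes refl = 0 , at-p , load-bound adm p
    where
    at-p : load (unit p p) p ≡ capacity (unit p p)
    at-p rewrite capacity-unit p p | 𝟙-diag p = refl
  ... | no m≢p = 2 , off-p , roomy m m≢p
    where
    off-p : 2 + load (unit p p) m ≡ capacity (unit p p)
    off-p rewrite capacity-unit p p | 𝟙-diag p | 𝟙-offdiag (m≢p ∘ sym) = refl

offdiagonal-peeling : ∀ {d} {μ : Margins d} {i j} → Admissible μ → diag μ ≡ 0 → i ≢ j →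
                      1 ≤ rows μ i → 1 ≤ cols μ j →
                      (∀ m → m ≢ i → m ≢ j → 1 + load μ m ≤ capacity μ) → Peeling μ
offdiagonal-peeling {d} {μ} {i} {j} adm t≡0 i≢j 1≤rᵢ 1≤cⱼ roomy =
  peel-unit i j split (admissible-⊖ split adm (trans (sum-𝟙 j) (sym (sum-𝟙 i))) rest-diag room)
  where
  rest : Margins d
  rest = μ ⊖ unit i j
  split : μ ≋ rest ⊕ unit i j
  split = ⊖-⊕ (record { rows-≤ = 𝟙≤ 1≤rᵢ ; cols-≤ = 𝟙≤ 1≤cⱼ
                      ; diag-≤ = subst (_≤ diag μ) (sym (𝟙-offdiag i≢j)) z≤n })
  rest-diag : diag rest ≤ sum (λ m → rows rest m ⊓ cols rest m)
  rest-diag rewrite t≡0 | ℕ.0∸n≡0 (𝟙 i j) = z≤n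
  room : ∀ m → Room (unit i j) μ m
  room m with m Fin.≟ i | m Fin.≟ j
  ... | yes refl | _ = 0 , at-i , load-bound adm i
    where
    at-i : load (unit i j) i ≡ capacity (unit i j)
    at-i rewrite capacity-unit i j | 𝟙-diag i | 𝟙-offdiag i≢j | 𝟙-offdiag (i≢j ∘ sym) = refl
  ... | no _ | yes refl = 0 , at-j , load-bound adm j
    where
    at-j : load (unit i j) j ≡ capacity (unit i j)
    at-j rewrite capacity-unit i j | 𝟙-diag j | 𝟙-offdiag i≢j = refl
  ... | no m≢i | no m≢j = 1 , elsewhere , roomy m m≢i m≢j
    where
    elsewhere : 1 + load (unit i j) m ≡ capacity (unit i j)
    elsewhere rewrite capacity-unit i j | 𝟙-offdiag i≢j | 𝟙-offdiag (m≢i ∘ sym) | 𝟙-offdiag (m≢j ∘ sym)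
      = refl

hole-peeling : ∀ {d} {μ : Margins d} {k l} → Admissible μ → diag μ ≡ 1 → k ≢ l →
               1 ≤ rows μ k → 1 ≤ cols μ k → 1 ≤ rows μ l → 1 ≤ cols μ l →
               load μ k ≤ total μ → load μ l ≤ total μ →
               (∀ m → m ≢ k → m ≢ l → load μ m ≡ 0) → Peeling μ
hole-peeling {d} {μ} {k} {l} adm t≡1 k≢l 1≤rₖ 1≤cₖ 1≤rₗ 1≤cₗ loadₖ≤ loadₗ≤ rest-empty =
  peel-hole k≢l split (admissible-⊖ split adm refl rest-diag room) rest-diag≡0
  where
  rest : Margins d
  rest = μ ⊖ hole k l
  split : μ ≋ rest ⊕ hole k l
  split = ⊖-⊕ (record { rows-≤ = 𝟙+𝟙≤ k≢l 1≤rₖ 1≤rₗ ; cols-≤ = 𝟙+𝟙≤ k≢l 1≤cₖ 1≤cₗ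
                      ; diag-≤ = ℕ.≤-reflexive (sym t≡1) })
  rest-diag≡0 : diag rest ≡ 0
  rest-diag≡0 = cong (_∸ 1) t≡1
  rest-diag : diag rest ≤ sum (λ m → rows rest m ⊓ cols rest m)
  rest-diag = subst (_≤ sum (λ m → rows rest m ⊓ cols rest m)) (sym rest-diag≡0) z≤n
  near : ∀ {m} → load μ m ≤ total μ → 1 + load μ m ≤ capacity μ
  near {m} load≤ = subst (1 + load μ m ≤_) (trans (ℕ.+-comm 1 (total μ)) (cong (total μ +_) (sym t≡1)))
                         (s≤s load≤)
  three≤capacity : 3 ≤ capacity μ
  three≤capacity = subst (3 ≤_) (sym (trans (capacity-⊕ {ν = rest} {hole k l} split)
                                             (cong (capacity rest +_) (capacity-hole k l))))
                         (ℕ.m≤n+m 3 (capacity rest))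
  room : ∀ m → Room (hole k l) μ m
  room m with m Fin.≟ k | m Fin.≟ l
  ... | yes refl | _ = 1 , at-k , near loadₖ≤
    where
    at-k : 1 + load (hole k l) k ≡ capacity (hole k l)
    at-k rewrite capacity-hole k l | 𝟙-diag k | 𝟙-offdiag (k≢l ∘ sym) = refl
  ... | no _ | yes refl = 1 , at-l , near loadₗ≤
    where
    at-l : 1 + load (hole k l) l ≡ capacity (hole k l)
    at-l rewrite capacity-hole k l | 𝟙-diag l | 𝟙-offdiag k≢l = refl
  ... | no m≢k | no m≢l =
    3 , elsewhere , subst (λ x → 3 + x ≤ capacity μ) (sym (rest-empty m m≢k m≢l)) three≤capacity
    where
    elsewhere : 3 + load (hole k l) m ≡ capacity (hole k l)
    elsewhere rewrite capacity-hole k l | 𝟙-offdiag (m≢k ∘ sym) | 𝟙-offdiag (m≢l ∘ sym) = refl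

diagonal-support : Admissible μ → 1 ≤ diag μ → ∃ λ p → 1 ≤ rows μ p × 1 ≤ cols μ p
diagonal-support {μ = μ} adm 1≤t
  with positive-entry (λ m → rows μ m ⊓ cols μ m) (ℕ.≤-trans 1≤t (diag-bound adm))
... | p , 1≤min = p , ℕ.≤-trans 1≤min (ℕ.m⊓n≤m _ _) , ℕ.≤-trans 1≤min (ℕ.m⊓n≤n _ _)

positive-rows-or-cols : 1 ≤ load μ m → 1 ≤ rows μ m ⊎ 1 ≤ cols μ m
positive-rows-or-cols {μ = μ} {m} 1≤load with 1 ℕ.≤? rows μ m
... | yes 1≤r = inj₁ 1≤r
... | no  1≰r = inj₂ (subst (λ r → 1 ≤ r + cols μ m) (1≰n⇒n≡0 1≰r) 1≤load)

sum-load : Admissible μ → sum (load μ) ≡ total μ + total μ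
sum-load {μ = μ} adm = trans (∑-distrib-+ (rows μ) (cols μ)) (cong (total μ +_) (balanced adm))

rows≤cols-of-heavy : total μ ≤ load μ m → p ≢ m → rows μ p ≤ cols μ m
rows≤cols-of-heavy {μ = μ} {m} heavy p≢m =
  heavy⇒other≤ (cols μ) (rows μ) p≢m (subst (total μ ≤_) (ℕ.+-comm (rows μ m) (cols μ m)) heavy)

cols≤rows-of-heavy : Admissible μ → total μ ≤ load μ m → p ≢ m → cols μ p ≤ rows μ m
cols≤rows-of-heavy {μ = μ} adm heavy p≢m =
  heavy⇒other≤ (rows μ) (cols μ) p≢m (subst (_≤ _) (sym (balanced adm)) heavy)

positive-at-heavy : Admissible μ → total μ ≤ load μ m → 1 ≤ rows μ p → 1 ≤ cols μ p →
                    1 ≤ rows μ m × 1 ≤ cols μ m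
positive-at-heavy {μ = μ} {m} {p} adm heavy 1≤rₚ 1≤cₚ with p Fin.≟ m
... | yes refl = 1≤rₚ , 1≤cₚ
... | no  p≢m  = ℕ.≤-trans 1≤cₚ (cols≤rows-of-heavy adm heavy p≢m)
               , ℕ.≤-trans 1≤rₚ (rows≤cols-of-heavy {μ = μ} heavy p≢m)

heavy-pair-bound : Admissible μ → m₁ ≢ m₂ → total μ ≤ load μ m₂ → load μ m₁ ≤ total μ
heavy-pair-bound {μ = μ} {m₁} {m₂} adm m₁≢m₂ heavy₂ = ℕ.+-cancelʳ-≤ (total μ) _ _ (begin
  load μ m₁ + total μ    ≤⟨ ℕ.+-monoʳ-≤ (load μ m₁) heavy₂ ⟩
  load μ m₁ + load μ m₂  ≤⟨ pair≤sum (load μ) (λ _ → z≤n) m₁≢m₂ ⟩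
  sum (load μ)           ≡⟨ sum-load adm ⟩
  total μ + total μ      ∎)
  where open ℕ.≤-Reasoning

heavy-pair-rest : Admissible μ → m₁ ≢ m₂ → total μ ≤ load μ m₁ → total μ ≤ load μ m₂ →
                  ∀ m → m ≢ m₁ → m ≢ m₂ → load μ m ≡ 0
heavy-pair-rest {μ = μ} {m₁} {m₂} adm m₁≢m₂ heavy₁ heavy₂ m m≢m₁ m≢m₂ =
  ℕ.n≤0⇒n≡0 (ℕ.+-cancelˡ-≤ N _ 0 (ℕ.+-cancelˡ-≤ N _ _ (begin
    N + (N + load μ m)                  ≤⟨ ℕ.+-mono-≤ heavy₁ (ℕ.+-monoˡ-≤ (load μ m) heavy₂) ⟩
    load μ m₁ + (load μ m₂ + load μ m)  ≤⟨ triple≤sum (load μ) (λ _ → z≤n)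
                                                      m₁≢m₂ (m≢m₁ ∘ sym) (m≢m₂ ∘ sym) ⟩
    sum (load μ)                        ≡⟨ sum-load adm ⟩
    N + N                               ≡⟨ cong (N +_) (ℕ.+-identityʳ N) ⟨
    N + (N + 0)                         ∎)))
  where
  open ℕ.≤-Reasoning
  N : ℕ
  N = total μ

heavy-pair-room : Admissible μ → 1 ≤ total μ → m₁ ≢ m₂ →
                  total μ ≤ load μ m₁ → total μ ≤ load μ m₂ →
                  ∀ m → m ≢ m₁ → m ≢ m₂ → 1 + load μ m ≤ capacity μ
heavy-pair-room {μ = μ} adm 1≤N m₁≢m₂ heavy₁ heavy₂ m m≢m₁ m≢m₂ =
  subst (λ x → 1 + x ≤ capacity μ) (sym (heavy-pair-rest adm m₁≢m₂ heavy₁ heavy₂ m m≢m₁ m≢m₂))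
        (ℕ.≤-trans 1≤N (ℕ.m≤m+n (total μ) (diag μ)))

tight⇒heavy-diag≥1 : 1 ≤ diag μ → capacity μ ≤ 1 + load μ m → total μ ≤ load μ m
tight⇒heavy-diag≥1 {μ = μ} {m} 1≤t tight = ℕ.≤-pred (begin
  1 + total μ   ≡⟨ ℕ.+-comm 1 (total μ) ⟩
  total μ + 1   ≤⟨ ℕ.+-monoʳ-≤ (total μ) 1≤t ⟩
  capacity μ    ≤⟨ tight ⟩
  1 + load μ m  ∎)
  where open ℕ.≤-Reasoning

capacity-diag≡0 : diag μ ≡ 0 → capacity μ ≡ total μ
capacity-diag≡0 {μ = μ} t≡0 = trans (cong (total μ +_) t≡0) (ℕ.+-identityʳ (total μ))

tight⇒heavy-diag≡0 : diag μ ≡ 0 → capacity μ ≤ load μ m → total μ ≤ load μ m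
tight⇒heavy-diag≡0 {μ = μ} t≡0 = subst (_≤ _) (capacity-diag≡0 {μ = μ} t≡0)

-- m is tight when removing a diagonal unit away from m would break the load bound at m; two
-- tight indices force diag μ ≡ 1 and leave the rest empty, which is where a hole gets peeled.
peeling-diag≥1 : Admissible μ → 1 ≤ diag μ → Peeling μ
peeling-diag≥1 {μ = μ} adm 1≤t
  with diagonal-support adm 1≤t | noneUniqueOrPair (λ m → capacity μ ℕ.≤? 1 + load μ m)
... | p , 1≤rₚ , 1≤cₚ | none roomy =
  diagonal-peeling adm 1≤rₚ 1≤cₚ 1≤t (λ m _ → ℕ.≰⇒> (roomy m))
... | p , 1≤rₚ , 1≤cₚ | unique m tight roomy =
  let 1≤rₘ , 1≤cₘ = positive-at-heavy adm (tight⇒heavy-diag≥1 {μ = μ} 1≤t tight) 1≤rₚ 1≤cₚ in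
  diagonal-peeling adm 1≤rₘ 1≤cₘ 1≤t (λ m′ m′≢m → ℕ.≰⇒> (roomy m′ m′≢m))
... | p , 1≤rₚ , 1≤cₚ | pair {m₁} {m₂} m₁≢m₂ tight₁ tight₂ =
  let 1≤r₁ , 1≤c₁ = positive-at-heavy adm heavy₁ 1≤rₚ 1≤cₚ
      1≤r₂ , 1≤c₂ = positive-at-heavy adm heavy₂ 1≤rₚ 1≤cₚ in
  hole-peeling adm t≡1 m₁≢m₂ 1≤r₁ 1≤c₁ 1≤r₂ 1≤c₂
    (heavy-pair-bound adm m₁≢m₂ heavy₂) (heavy-pair-bound adm (m₁≢m₂ ∘ sym) heavy₁)
    (heavy-pair-rest adm m₁≢m₂ heavy₁ heavy₂)
  where
  open ℕ.≤-Reasoning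
  heavy₁ : total μ ≤ load μ m₁
  heavy₁ = tight⇒heavy-diag≥1 {μ = μ} 1≤t tight₁
  heavy₂ : total μ ≤ load μ m₂
  heavy₂ = tight⇒heavy-diag≥1 {μ = μ} 1≤t tight₂
  t≡1 : diag μ ≡ 1
  t≡1 = ℕ.≤-antisym (ℕ.+-cancelˡ-≤ (total μ) _ _ (begin
    total μ + diag μ  ≤⟨ tight₁ ⟩
    1 + load μ m₁     ≤⟨ s≤s (heavy-pair-bound adm m₁≢m₂ heavy₂) ⟩
    1 + total μ       ≡⟨ ℕ.+-comm 1 (total μ) ⟩
    total μ + 1       ∎)) 1≤t

offdiagonal-peeling-through : Admissible μ → diag μ ≡ 0 → ∀ m₁ → 1 ≤ rows μ m₁ ⊎ 1 ≤ cols μ m₁ →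
                              (∀ m → m ≢ m₁ → 1 + load μ m ≤ capacity μ) → Peeling μ
offdiagonal-peeling-through {μ = μ} adm t≡0 m₁ (inj₁ 1≤r) roomy
  with other-positive-entry (cols μ) m₁ (begin-strict
    cols μ m₁     <⟨ ℕ.m<n+m (cols μ m₁) 1≤r ⟩
    load μ m₁     ≤⟨ load-bound adm m₁ ⟩
    capacity μ    ≡⟨ capacity-diag≡0 {μ = μ} t≡0 ⟩
    total μ       ≡⟨ balanced adm ⟨
    sum (cols μ)  ∎)
  where open ℕ.≤-Reasoning
... | j , j≢m₁ , 1≤cⱼ =
  offdiagonal-peeling adm t≡0 (j≢m₁ ∘ sym) 1≤r 1≤cⱼ (λ m m≢m₁ _ → roomy m m≢m₁)
offdiagonal-peeling-through {μ = μ} adm t≡0 m₁ (inj₂ 1≤c) roomy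
  with other-positive-entry (rows μ) m₁ (begin-strict
    rows μ m₁   <⟨ ℕ.m<m+n (rows μ m₁) 1≤c ⟩
    load μ m₁   ≤⟨ load-bound adm m₁ ⟩
    capacity μ  ≡⟨ capacity-diag≡0 {μ = μ} t≡0 ⟩
    total μ     ∎)
  where open ℕ.≤-Reasoning
... | i , i≢m₁ , 1≤rᵢ =
  offdiagonal-peeling adm t≡0 i≢m₁ 1≤rᵢ 1≤c (λ m _ m≢m₁ → roomy m m≢m₁)

offdiagonal-peeling-heavy-pair : Admissible μ → diag μ ≡ 0 → 1 ≤ total μ → m₁ ≢ m₂ →
                                 total μ ≤ load μ m₁ → total μ ≤ load μ m₂ → Peeling μ
offdiagonal-peeling-heavy-pair {μ = μ} {m₁} {m₂} adm t≡0 1≤N m₁≢m₂ heavy₁ heavy₂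
  with positive-rows-or-cols {μ = μ} {m₁} (ℕ.≤-trans 1≤N heavy₁)
... | inj₁ 1≤r₁ = offdiagonal-peeling adm t≡0 m₁≢m₂ 1≤r₁
                    (ℕ.≤-trans 1≤r₁ (rows≤cols-of-heavy {μ = μ} heavy₂ m₁≢m₂))
                    (λ m m≢m₁ m≢m₂ → heavy-pair-room adm 1≤N m₁≢m₂ heavy₁ heavy₂ m m≢m₁ m≢m₂)
... | inj₂ 1≤c₁ = offdiagonal-peeling adm t≡0 (m₁≢m₂ ∘ sym)
                    (ℕ.≤-trans 1≤c₁ (cols≤rows-of-heavy adm heavy₂ m₁≢m₂)) 1≤c₁
                    (λ m m≢m₂ m≢m₁ → heavy-pair-room adm 1≤N m₁≢m₂ heavy₁ heavy₂ m m≢m₁ m≢m₂)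

-- With diag μ ≡ 0, m is tight when removing an off-diagonal unit avoiding m would break its bound.
peeling-diag≡0 : Admissible μ → diag μ ≡ 0 → 1 ≤ total μ → Peeling μ
peeling-diag≡0 {μ = μ} adm t≡0 1≤N with noneUniqueOrPair (λ m → capacity μ ℕ.≤? load μ m)
... | none roomy =
  let i , 1≤rᵢ = positive-entry (rows μ) 1≤N in
  offdiagonal-peeling-through adm t≡0 i (inj₁ 1≤rᵢ) (λ m _ → ℕ.≰⇒> (roomy m))
... | unique m tight roomy =
  offdiagonal-peeling-through adm t≡0 m
    (positive-rows-or-cols {μ = μ} {m} (ℕ.≤-trans 1≤N (tight⇒heavy-diag≡0 {μ = μ} t≡0 tight)))
    (λ m′ m′≢m → ℕ.≰⇒> (roomy m′ m′≢m))
... | pair m₁≢m₂ tight₁ tight₂ =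
  offdiagonal-peeling-heavy-pair adm t≡0 1≤N m₁≢m₂
    (tight⇒heavy-diag≡0 {μ = μ} t≡0 tight₁) (tight⇒heavy-diag≡0 {μ = μ} t≡0 tight₂)

peeling : Admissible μ → 1 ≤ total μ → Peeling μ
peeling {μ = μ} adm 1≤N with diag μ ℕ.≟ 0
... | yes t≡0 = peeling-diag≡0 adm t≡0 1≤N
... | no  t≢0 = peeling-diag≥1 adm (ℕ.n≢0⇒n>0 t≢0)

decompose : ∀ {d} (μ : Margins d) → Admissible μ → Decomposition μ
decompose {d} = All.wfRec (On.wellFounded total <-wellFounded) 0ℓ (λ μ → Admissible μ → Decomposition μ) step
  where
  step : ∀ (μ : Margins d) → (∀ {ν} → total ν < total μ → Admissible ν → Decomposition ν) →
         Admissible μ → Decomposition μ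
  step μ rec adm with total μ ℕ.≟ 0
  ... | yes N≡0 = empty-decomposition adm N≡0
  ... | no  N≢0 with peeling adm (ℕ.n≢0⇒n>0 N≢0)
  ...   | peel-unit i j {ν} μ≋ adm′ =
    decomposition-⊕-unit {ν = ν} {i = i} {j} μ≋
      (rec (total-decreases {ν = ν} {unit i j} μ≋ (ℕ.≤-reflexive (sym (total-unit i j)))) adm′)
  ...   | peel-hole {k} {l} {ν} k≢l μ≋ adm′ t≡0 =
    decomposition-⊕-hole {ν = ν} k≢l μ≋ t≡0
      (rec (total-decreases {ν = ν} {hole k l} μ≋ (subst (1 ≤_) (sym (total-hole k l)) (s≤s z≤n))) adm′)

open import Data.Integer using (+_; -[1+_]; ∣_∣)

module _ {d : ℕ} where

  classify : Fin (Dim d) → (Fin d ⊎ Fin d) ⊎ Fin 1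
  classify c = Sum.map₁ (splitAt d) (splitAt (d + d) c)

  classify-colIx : (j : Fin d) → classify (colIx j) ≡ inj₁ (inj₁ j)
  classify-colIx j rewrite splitAt-↑ˡ (d + d) (j ↑ˡ d) 1 | splitAt-↑ˡ d j d = refl

  classify-rowIx : (i : Fin d) → classify (rowIx i) ≡ inj₁ (inj₂ i)
  classify-rowIx i rewrite splitAt-↑ˡ (d + d) (d ↑ʳ i) 1 | splitAt-↑ʳ d d i = refl

  classify-lastIx : classify (lastIx {d}) ≡ inj₂ zero
  classify-lastIx rewrite splitAt-↑ʳ (d + d) 1 zero = refl

  data Coordinate : Fin (Dim d) → Set where
    col  : (j : Fin d) → Coordinate (colIx j)
    row  : (i : Fin d) → Coordinate (rowIx i)
    last : Coordinate (lastIx {d})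

  coordinate : (c : Fin (Dim d)) → Coordinate c
  coordinate c with splitAt (d + d) c in eq
  ... | inj₂ zero = subst Coordinate (splitAt⁻¹-↑ʳ eq) last
  ... | inj₁ c′ with splitAt d c′ in eq′
  ...   | inj₁ j = subst Coordinate (trans (cong (_↑ˡ 1) (splitAt⁻¹-↑ˡ eq′)) (splitAt⁻¹-↑ˡ eq)) (col j)
  ...   | inj₂ i = subst Coordinate (trans (cong (_↑ˡ 1) (splitAt⁻¹-↑ʳ eq′)) (splitAt⁻¹-↑ˡ eq)) (row i)

  ≗-by-coordinates : {u w : Vec d} → (∀ (j : Fin d) → u (colIx j) ≡ w (colIx j)) →
                     (∀ (i : Fin d) → u (rowIx i) ≡ w (rowIx i)) → u (lastIx {d}) ≡ w (lastIx {d}) →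
                     u ≗ w
  ≗-by-coordinates {u} {w} on-col on-row on-last c = by (coordinate c)
    where
    by : ∀ {c} → Coordinate c → u c ≡ w c
    by (col j) = on-col j
    by (row i) = on-row i
    by last    = on-last

  colIx-injective : {i j : Fin d} → colIx i ≡ colIx j → i ≡ j
  colIx-injective {i} {j} eq with trans (sym (classify-colIx i)) (trans (cong classify eq) (classify-colIx j))
  ... | refl = refl

  rowIx-injective : {i j : Fin d} → rowIx i ≡ rowIx j → i ≡ j
  rowIx-injective {i} {j} eq with trans (sym (classify-rowIx i)) (trans (cong classify eq) (classify-rowIx j))
  ... | refl = refl

  colIx≢rowIx : {j i : Fin d} → colIx j ≢ rowIx i
  colIx≢rowIx {j} {i} eq with trans (sym (classify-colIx j)) (trans (cong classify eq) (classify-rowIx i))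
  ... | ()

  colIx≢lastIx : {j : Fin d} → colIx j ≢ lastIx {d}
  colIx≢lastIx {j} eq with trans (sym (classify-colIx j)) (trans (cong classify eq) classify-lastIx)
  ... | ()

  rowIx≢lastIx : {i : Fin d} → rowIx i ≢ lastIx {d}
  rowIx≢lastIx {i} eq with trans (sym (classify-rowIx i)) (trans (cong classify eq) classify-lastIx)
  ... | ()

  e-self : (p : Fin (Dim d)) → e d p p ≡ + 1
  e-self p with p Fin.≟ p
  ... | yes _  = refl
  ... | no p≢p = contradiction refl p≢p

  e-other : {p q : Fin (Dim d)} → p ≢ q → e d p q ≡ + 0
  e-other {p} {q} p≢q with p Fin.≟ q
  ... | yes p≡q = contradiction p≡q p≢q
  ... | no  _   = refl

  δ-self : (i : Fin d) → δ i i ≡ + 1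
  δ-self i with i Fin.≟ i
  ... | yes _  = refl
  ... | no i≢i = contradiction refl i≢i

  δ-other : {i j : Fin d} → i ≢ j → δ i j ≡ + 0
  δ-other {i} {j} i≢j with i Fin.≟ j
  ... | yes i≡j = contradiction i≡j i≢j
  ... | no  _   = refl

  e-along : (f : Fin d → Fin (Dim d)) → (∀ {i j} → f i ≡ f j → i ≡ j) →
            ∀ i j → e d (f i) (f j) ≡ δ i j
  e-along f f-injective i j with i Fin.≟ j
  ... | yes refl = e-self (f i)
  ... | no  i≢j  = e-other (i≢j ∘ f-injective)

  a-at : ∀ (i j : Fin d) {c x y z} →
         e d (colIx j) c ≡ x → e d (rowIx i) c ≡ y → e d (lastIx {d}) c ≡ z →
         a d i j c ≡ x ℤ.+ y ℤ.+ δ i j ℤ.* z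
  a-at i j ex ey ez = cong₂ ℤ._+_ (cong₂ ℤ._+_ ex ey) (cong (δ i j ℤ.*_) ez)

  a-colIx : ∀ (i j m : Fin d) → a d i j (colIx m) ≡ δ j m
  a-colIx i j m =
    trans (a-at i j (e-along colIx colIx-injective j m) (e-other (colIx≢rowIx ∘ sym))
                    (e-other (colIx≢lastIx ∘ sym)))
          (trans (cong₂ ℤ._+_ (ℤ.+-identityʳ (δ j m)) (ℤ.*-zeroʳ (δ i j))) (ℤ.+-identityʳ (δ j m)))

  a-rowIx : ∀ (i j m : Fin d) → a d i j (rowIx m) ≡ δ i m
  a-rowIx i j m =
    trans (a-at i j (e-other colIx≢rowIx) (e-along rowIx rowIx-injective i m)
                    (e-other (rowIx≢lastIx ∘ sym)))
          (trans (cong₂ ℤ._+_ (ℤ.+-identityˡ (δ i m)) (ℤ.*-zeroʳ (δ i j))) (ℤ.+-identityʳ (δ i m)))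

  a-lastIx : ∀ (i j : Fin d) → a d i j (lastIx {d}) ≡ δ i j
  a-lastIx i j =
    trans (a-at i j (e-other colIx≢lastIx) (e-other rowIx≢lastIx) (e-self (lastIx {d})))
          (trans (ℤ.+-identityˡ (δ i j ℤ.* + 1)) (ℤ.*-identityʳ (δ i j)))

  -- Column sums, row sums and trace sit at e_j, e_(d+i) and e_(2d+1), as they do in Σ xᵢⱼ aᵢⱼ.
  embed : Margins d → Vec d
  embed μ c = [ [ +_ ∘ cols μ , +_ ∘ rows μ ]′ , (λ _ → + diag μ) ]′ (classify c)

  embed-colIx : ∀ (μ : Margins d) j → embed μ (colIx j) ≡ + cols μ j
  embed-colIx μ j rewrite classify-colIx j = refl

  embed-rowIx : ∀ (μ : Margins d) i → embed μ (rowIx i) ≡ + rows μ i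
  embed-rowIx μ i rewrite classify-rowIx i = refl

  embed-lastIx : ∀ (μ : Margins d) → embed μ (lastIx {d}) ≡ + diag μ
  embed-lastIx μ rewrite classify-lastIx = refl

  embed-≋ : {μ ν : Margins d} → μ ≋ ν → embed μ ≗ embed ν
  embed-≋ {μ} {ν} μ≋ν = ≗-by-coordinates
    (λ j → trans (embed-colIx μ j) (trans (cong +_ (cols-≡ μ≋ν j)) (sym (embed-colIx ν j))))
    (λ i → trans (embed-rowIx μ i) (trans (cong +_ (rows-≡ μ≋ν i)) (sym (embed-rowIx ν i))))
    (trans (embed-lastIx μ) (trans (cong +_ (diag-≡ μ≋ν)) (sym (embed-lastIx ν))))

  embed-injective : {μ ν : Margins d} → embed μ ≗ embed ν → μ ≋ ν
  embed-injective {μ} {ν} μ≗ν = record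
    { rows-≡ = λ i → ℤ.+-injective (trans (sym (embed-rowIx μ i)) (trans (μ≗ν (rowIx i)) (embed-rowIx ν i)))
    ; cols-≡ = λ j → ℤ.+-injective (trans (sym (embed-colIx μ j)) (trans (μ≗ν (colIx j)) (embed-colIx ν j)))
    ; diag-≡ = ℤ.+-injective (trans (sym (embed-lastIx μ)) (trans (μ≗ν (lastIx {d})) (embed-lastIx ν)))
    }

  embed-⊕ : (μ ν : Margins d) → ∀ c → embed (μ ⊕ ν) c ≡ embed μ c ℤ.+ embed ν c
  embed-⊕ μ ν = ≗-by-coordinates
    (λ j → trans (embed-colIx (μ ⊕ ν) j) (trans (ℤ.pos-+ (cols μ j) (cols ν j))
                 (sym (cong₂ ℤ._+_ (embed-colIx μ j) (embed-colIx ν j)))))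
    (λ i → trans (embed-rowIx (μ ⊕ ν) i) (trans (ℤ.pos-+ (rows μ i) (rows ν i))
                 (sym (cong₂ ℤ._+_ (embed-rowIx μ i) (embed-rowIx ν i)))))
    (trans (embed-lastIx (μ ⊕ ν)) (trans (ℤ.pos-+ (diag μ) (diag ν))
           (sym (cong₂ ℤ._+_ (embed-lastIx μ) (embed-lastIx ν)))))

  embed-𝟘 : ∀ c → embed 𝟘 c ≡ + 0
  embed-𝟘 = ≗-by-coordinates (embed-colIx 𝟘) (embed-rowIx 𝟘) (embed-lastIx 𝟘)

  sub-embed-⊕ : {v : Vec d} {μ ν : Margins d} → v ≗ embed (μ ⊕ ν) → sub d v (embed ν) ≗ embed μ
  sub-embed-⊕ {v} {μ} {ν} v≗ c =
    trans (cong (ℤ._- embed ν c) (trans (v≗ c) (embed-⊕ μ ν c))) (cancel (embed μ c) (embed ν c))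
    where
    cancel : ∀ p q → p ℤ.+ q ℤ.- q ≡ p
    cancel = solve-∀

  embed-⊕-sub : {u w : Vec d} {μ ν : Margins d} → sub d u w ≗ embed μ → w ≗ embed ν → u ≗ embed (μ ⊕ ν)
  embed-⊕-sub {u} {w} {μ} {ν} u-w≗ w≗ c =
    trans (split (u c) (w c)) (trans (cong₂ ℤ._+_ (u-w≗ c) (w≗ c)) (sym (embed-⊕ μ ν c)))
    where
    split : ∀ p q → p ≡ p ℤ.- q ℤ.+ q
    split = solve-∀

module Combination {c ℓ} (R : Semiring c ℓ) (φ : ℤ → Semiring.Carrier R)
  (φ-δ : ∀ {n} (i j : Fin n) → φ (δ i j) ≡ KroneckerSum.𝟙 R i j) where

  private
    module R = Semiring R
    module K = KroneckerSum R

  combination : ∀ {d} → (Fin d → Fin d → R.Carrier) → Fin (Dim d) → R.Carrier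
  combination {d} y c = K.sum (λ i → K.sum (λ j → y i j R.* φ (a d i j c)))

  combination-colIx : ∀ {d} (y : Fin d → Fin d → R.Carrier) m → combination y (colIx m) R.≈ K.colSum y m
  combination-colIx y m = R.trans
    (K.sum-cong-≋ λ i → K.sum-cong-≋ λ j →
      R.*-congˡ {y i j} (R.reflexive (trans (cong φ (a-colIx i j m)) (φ-δ j m))))
    (K.sifted-colSum y m)

  combination-rowIx : ∀ {d} (y : Fin d → Fin d → R.Carrier) m → combination y (rowIx m) R.≈ K.rowSum y m
  combination-rowIx y m = R.trans
    (K.sum-cong-≋ λ i → K.sum-cong-≋ λ j →
      R.*-congˡ {y i j} (R.reflexive (trans (cong φ (a-rowIx i j m)) (φ-δ i m))))
    (K.sifted-rowSum y m)

  combination-lastIx : ∀ {d} (y : Fin d → Fin d → R.Carrier) → combination y (lastIx {d}) R.≈ K.trace y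
  combination-lastIx y = R.trans
    (K.sum-cong-≋ λ i → K.sum-cong-≋ λ j →
      R.*-congˡ {y i j} (R.reflexive (trans (cong φ (a-lastIx i j)) (φ-δ i j))))
    (K.sifted-trace y)

image-of-δ : ∀ {c ℓ} (R : Semiring c ℓ) (φ : ℤ → Semiring.Carrier R) →
             φ (+ 1) ≡ Semiring.1# R → φ (+ 0) ≡ Semiring.0# R →
             ∀ {n} (i j : Fin n) → φ (δ i j) ≡ KroneckerSum.𝟙 R i j
image-of-δ R φ φ1 φ0 i j with i Fin.≟ j
... | yes _ = φ1
... | no  _ = φ0

-- Q and Q_sat in terms of margins

module ℤΣ = KroneckerSum ℤ.+-*-semiring
module ℤC = Combination ℤ.+-*-semiring (λ z → z) (image-of-δ ℤ.+-*-semiring (λ z → z) refl refl)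

sumℤ≡sum : ∀ {n} (f : Fin n → ℤ) → sumℤ f ≡ ℤΣ.sum f
sumℤ≡sum {zero}  f = refl
sumℤ≡sum {suc n} f = cong (ℤ._+_ (f zero)) (sumℤ≡sum (f ∘ suc))

double-sumℤ≡sum : ∀ {n} (f : Fin n → Fin n → ℤ) →
                  sumℤ (λ i → sumℤ (f i)) ≡ ℤΣ.sum (λ i → ℤΣ.sum (f i))
double-sumℤ≡sum f = trans (sumℤ≡sum (λ i → sumℤ (f i))) (ℤΣ.sum-cong-≗ (λ i → sumℤ≡sum (f i)))

open SumHomomorphism ℕ.+-0-monoid ℤ.+-0-monoid +_ refl ℤ.pos-+ renaming (sum-homo to +-sum)

combinationℤ-embed : (x : Matrix d) →
                     (λ c → sumℤ (λ i → sumℤ (λ j → + x i j ℤ.* a d i j c))) ≗ embed (marginsOf x)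
combinationℤ-embed {d} x c = trans (double-sumℤ≡sum (λ i j → y i j ℤ.* a d i j c))
  (≗-by-coordinates {u = ℤC.combination y} {w = embed (marginsOf x)}
    (λ m → trans (ℤC.combination-colIx y m) (trans (sym (+-sum (λ i → x i m))) (sym (embed-colIx (marginsOf x) m))))
    (λ m → trans (ℤC.combination-rowIx y m) (trans (sym (+-sum (x m))) (sym (embed-rowIx (marginsOf x) m))))
    (trans (ℤC.combination-lastIx y) (trans (sym (+-sum (λ i → x i i))) (sym (embed-lastIx (marginsOf x)))))
    c)
  where
  y : Fin d → Fin d → ℤ
  y i j = + x i j

inQ⇒margins : {v : Vec d} → InQ d v → Σ (Matrix d) λ x → v ≗ embed (marginsOf x)
inQ⇒margins (x , v≡) = x , λ c → trans (v≡ c) (combinationℤ-embed x c)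

margins⇒inQ : {v : Vec d} (x : Matrix d) → v ≗ embed (marginsOf x) → InQ d v
margins⇒inQ x v≗ = x , λ c → trans (v≗ c) (sym (combinationℤ-embed x c))

-- toℚ z in normal form; with denominator 1, ℚ arithmetic on it reduces to ℤ arithmetic by computation.
ι : ℤ → ℚ
ι z = mkℚ z 0 (Coprimality.sym (Coprimality.1-coprimeTo _))

toℚ≡ι : ∀ z → toℚ z ≡ ι z
toℚ≡ι (+ n)    = ℚ.normalize-coprime {n} {0} (Coprimality.sym (Coprimality.1-coprimeTo _))
toℚ≡ι -[1+ n ] = cong ℚ.-_ (ℚ.normalize-coprime {suc n} {0} (Coprimality.sym (Coprimality.1-coprimeTo _)))

toℚ-+ : ∀ a b → toℚ (a ℤ.+ b) ≡ toℚ a ℚ.+ toℚ b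
toℚ-+ a b = begin
  toℚ (a ℤ.+ b)                  ≡⟨ cong toℚ (cong₂ ℤ._+_ (ℤ.*-identityʳ a) (ℤ.*-identityʳ b)) ⟨
  toℚ (a ℤ.* + 1 ℤ.+ b ℤ.* + 1)  ≡⟨⟩
  ι a ℚ.+ ι b                    ≡⟨ cong₂ ℚ._+_ (toℚ≡ι a) (toℚ≡ι b) ⟨
  toℚ a ℚ.+ toℚ b                ∎
  where open ≡.≡-Reasoning

toℚ-cancel-≤ : ∀ {a b} → toℚ a ℚ.≤ toℚ b → a ℤ.≤ b
toℚ-cancel-≤ {a} {b} le with subst₂ ℚ._≤_ (toℚ≡ι a) (toℚ≡ι b) le
... | *≤* a*1≤b*1 = subst₂ ℤ._≤_ (ℤ.*-identityʳ a) (ℤ.*-identityʳ b) a*1≤b*1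

toℚ-injective : ∀ {a b} → toℚ a ≡ toℚ b → a ≡ b
toℚ-injective {a} {b} eq = cong ℚ.↥_ (trans (sym (toℚ≡ι a)) (trans eq (toℚ≡ι b)))

fromℕ : ℕ → ℚ
fromℕ n = toℚ (+ n)

fromℕ-+ : ∀ m n → fromℕ (m + n) ≡ fromℕ m ℚ.+ fromℕ n
fromℕ-+ m n = trans (cong toℚ (ℤ.pos-+ m n)) (toℚ-+ (+ m) (+ n))

fromℕ-cancel-≤ : ∀ {m n} → fromℕ m ℚ.≤ fromℕ n → m ≤ n
fromℕ-cancel-≤ = ℤ.drop‿+≤+ ∘ toℚ-cancel-≤

fromℕ-injective : ∀ {m n} → fromℕ m ≡ fromℕ n → m ≡ n
fromℕ-injective = ℤ.+-injective ∘ toℚ-injective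

open SumHomomorphism ℕ.+-0-monoid ℚ.+-0-monoid fromℕ refl fromℕ-+ renaming (sum-homo to fromℕ-sum)

ℚ-semiring : Semiring 0ℓ 0ℓ
ℚ-semiring = CommutativeRing.semiring ℚ.+-*-commutativeRing

module ℚΣ = KroneckerSum ℚ-semiring
module ℚC = Combination ℚ-semiring toℚ (image-of-δ ℚ-semiring toℚ refl refl)
module ℚO = OrderedSum (Semiring.+-commutativeMonoid ℚ-semiring) ℚ.≤-isPreorder ℚ.+-mono-≤

sumℚ≡sum : ∀ {n} (f : Fin n → ℚ) → sumℚ f ≡ ℚΣ.sum f
sumℚ≡sum {zero}  f = refl
sumℚ≡sum {suc n} f = cong (ℚ._+_ (f zero)) (sumℚ≡sum (f ∘ suc))

double-sumℚ≡sum : ∀ {n} (f : Fin n → Fin n → ℚ) →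
                  sumℚ (λ i → sumℚ (f i)) ≡ ℚΣ.sum (λ i → ℚΣ.sum (f i))
double-sumℚ≡sum f = trans (sumℚ≡sum (λ i → sumℚ (f i))) (ℚΣ.sum-cong-≗ (λ i → sumℚ≡sum (f i)))

record IsMarginsOf (μ : Margins d) (y : Fin d → Fin d → ℚ) : Set where
  field
    on-rows : ∀ m → fromℕ (rows μ m) ≡ ℚΣ.rowSum y m
    on-cols : ∀ m → fromℕ (cols μ m) ≡ ℚΣ.colSum y m
    on-diag : fromℕ (diag μ) ≡ ℚΣ.trace y

nonnegative-margins-admissible : {μ : Margins d} (y : Fin d → Fin d → ℚ) → (∀ i j → 0ℚ ℚ.≤ y i j) →
                                 IsMarginsOf μ y → Admissible μ
nonnegative-margins-admissible {μ = μ} y y≥0 μ-of-y = record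
  { balanced   = fromℕ-injective (begin-equality
      fromℕ (sum (cols μ))     ≡⟨ fromℕ-sum (cols μ) ⟩
      ℚΣ.sum (fromℕ ∘ cols μ)  ≡⟨ ℚΣ.sum-cong-≗ on-cols ⟩
      ℚΣ.sum (ℚΣ.colSum y)     ≡⟨ ℚΣ.sum-colSum y ⟩
      ℚΣ.sum (ℚΣ.rowSum y)     ≡⟨ rows-total ⟨
      fromℕ (total μ)          ∎)
  ; diag-bound = fromℕ-cancel-≤ (begin
      fromℕ (diag μ)                              ≡⟨ on-diag ⟩
      ℚΣ.trace y                                  ≤⟨ ℚO.sum-mono-≤ diag≤min ⟩
      ℚΣ.sum (λ m → fromℕ (rows μ m ⊓ cols μ m))  ≡⟨ fromℕ-sum (λ m → rows μ m ⊓ cols μ m) ⟨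
      fromℕ (sum (λ m → rows μ m ⊓ cols μ m))     ∎)
  ; load-bound = λ m → fromℕ-cancel-≤ (begin
      fromℕ (load μ m)                       ≡⟨ fromℕ-+ (rows μ m) (cols μ m) ⟩
      fromℕ (rows μ m) ℚ.+ fromℕ (cols μ m)  ≡⟨ cong₂ ℚ._+_ (on-rows m) (on-cols m) ⟩
      ℚΣ.rowSum y m ℚ.+ ℚΣ.colSum y m        ≤⟨ ℚO.rowSum+colSum≤ y y≥0 m ⟩
      ℚΣ.sum (ℚΣ.rowSum y) ℚ.+ ℚΣ.trace y    ≡⟨ cong₂ ℚ._+_ rows-total on-diag ⟨
      fromℕ (total μ) ℚ.+ fromℕ (diag μ)     ≡⟨ fromℕ-+ (total μ) (diag μ) ⟨
      fromℕ (capacity μ)                     ∎)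
  }
  where
  open IsMarginsOf μ-of-y
  open ℚ.≤-Reasoning
  rows-total : fromℕ (total μ) ≡ ℚΣ.sum (ℚΣ.rowSum y)
  rows-total = trans (fromℕ-sum (rows μ)) (ℚΣ.sum-cong-≗ on-rows)
  diag≤min : ∀ m → y m m ℚ.≤ fromℕ (rows μ m ⊓ cols μ m)
  diag≤min m with ℕ.≤-total (rows μ m) (cols μ m)
  ... | inj₁ r≤c = subst (λ n → y m m ℚ.≤ fromℕ n) (sym (ℕ.m≤n⇒m⊓n≡m r≤c))
                     (subst (y m m ℚ.≤_) (sym (on-rows m)) (ℚO.single≤sum (y m) (y≥0 m) m))
  ... | inj₂ c≤r = subst (λ n → y m m ℚ.≤ fromℕ n) (sym (ℕ.m≥n⇒m⊓n≡n c≤r))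
                     (subst (y m m ℚ.≤_) (sym (on-cols m)) (ℚO.single≤sum (λ i → y i m) (λ i → y≥0 i m) m))

readMargins : Vec d → Margins d
readMargins {d} v = ⟨ (λ m → ∣ v (rowIx m) ∣) , (λ m → ∣ v (colIx m) ∣) , ∣ v (lastIx {d}) ∣ ⟩

nonnegative-coordinate : ∀ {z q} → toℚ z ≡ q → 0ℚ ℚ.≤ q → + ∣ z ∣ ≡ z
nonnegative-coordinate z≡q 0≤q =
  ℤ.0≤i⇒+∣i∣≡i (toℚ-cancel-≤ {+ 0} (subst (0ℚ ℚ.≤_) (sym z≡q) 0≤q))

qsat⇒admissible : {v : Vec d} → InQsat d v → Σ (Margins d) λ μ → v ≗ embed μ × Admissible μ
qsat⇒admissible {d} {v} (y , y≥0 , v≡) = μᵥ , v≗μᵥ , nonnegative-margins-admissible y y≥0 μᵥ-of-y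
  where
  μᵥ : Margins d
  μᵥ = readMargins v
  v≡combination : ∀ c → toℚ (v c) ≡ ℚC.combination y c
  v≡combination c = trans (v≡ c) (double-sumℚ≡sum (λ i j → y i j ℚ.* toℚ (a d i j c)))
  on-row : ∀ m → toℚ (v (rowIx m)) ≡ ℚΣ.rowSum y m
  on-row m = trans (v≡combination (rowIx m)) (ℚC.combination-rowIx y m)
  on-col : ∀ m → toℚ (v (colIx m)) ≡ ℚΣ.colSum y m
  on-col m = trans (v≡combination (colIx m)) (ℚC.combination-colIx y m)
  on-last : toℚ (v (lastIx {d})) ≡ ℚΣ.trace y
  on-last = trans (v≡combination (lastIx {d})) (ℚC.combination-lastIx y)
  row≥0 : ∀ m → + rows μᵥ m ≡ v (rowIx m)
  row≥0 m = nonnegative-coordinate (on-row m) (ℚO.sum-nonneg (y≥0 m))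
  col≥0 : ∀ m → + cols μᵥ m ≡ v (colIx m)
  col≥0 m = nonnegative-coordinate (on-col m) (ℚO.sum-nonneg (λ i → y≥0 i m))
  last≥0 : + diag μᵥ ≡ v (lastIx {d})
  last≥0 = nonnegative-coordinate on-last (ℚO.sum-nonneg (λ i → y≥0 i i))
  v≗μᵥ : v ≗ embed μᵥ
  v≗μᵥ = ≗-by-coordinates
    (λ j → trans (sym (col≥0 j)) (sym (embed-colIx μᵥ j)))
    (λ i → trans (sym (row≥0 i)) (sym (embed-rowIx μᵥ i)))
    (trans (sym last≥0) (sym (embed-lastIx μᵥ)))
  μᵥ-of-y : IsMarginsOf μᵥ y
  μᵥ-of-y = record
    { on-rows = λ m → trans (cong toℚ (row≥0 m)) (on-row m)
    ; on-cols = λ m → trans (cong toℚ (col≥0 m)) (on-col m)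
    ; on-diag = trans (cong toℚ last≥0) on-last
    }

+𝟙≡δ : ∀ {n} (i j : Fin n) → + 𝟙 i j ≡ δ i j
+𝟙≡δ i j with i Fin.≟ j
... | yes _ = refl
... | no  _ = refl

blockSum : ∀ d → Fin d → Fin d → Vec d
blockSum d k l c = a d l l c ℤ.+ a d l k c ℤ.+ a d k l c ℤ.+ a d k k c

blockSum≡2·hole : ∀ {d} {k l : Fin d} → k ≢ l → ∀ c → blockSum d k l c ≡ + 2 ℤ.* embed (hole k l) c
blockSum≡2·hole {d} {k} {l} k≢l = ≗-by-coordinates
  (λ m → begin
    blockSum d k l (colIx m)              ≡⟨ terms (a-colIx l l m) (a-colIx l k m) (a-colIx k l m) (a-colIx k k m) ⟩
    δ l m ℤ.+ δ k m ℤ.+ δ l m ℤ.+ δ k m   ≡⟨ alternating (δ k m) (δ l m) ⟩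
    + 2 ℤ.* (δ k m ℤ.+ δ l m)             ≡⟨ cong (+ 2 ℤ.*_) (trans (on-pair m)
                                                                    (sym (embed-colIx (hole k l) m))) ⟩
    + 2 ℤ.* embed (hole k l) (colIx m)    ∎)
  (λ m → begin
    blockSum d k l (rowIx m)              ≡⟨ terms (a-rowIx l l m) (a-rowIx l k m) (a-rowIx k l m) (a-rowIx k k m) ⟩
    δ l m ℤ.+ δ l m ℤ.+ δ k m ℤ.+ δ k m   ≡⟨ grouped (δ k m) (δ l m) ⟩
    + 2 ℤ.* (δ k m ℤ.+ δ l m)             ≡⟨ cong (+ 2 ℤ.*_) (trans (on-pair m)
                                                                    (sym (embed-rowIx (hole k l) m))) ⟩
    + 2 ℤ.* embed (hole k l) (rowIx m)    ∎)
  (begin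
    blockSum d k l (lastIx {d})           ≡⟨ terms (a-lastIx l l) (a-lastIx l k) (a-lastIx k l) (a-lastIx k k) ⟩
    δ l l ℤ.+ δ l k ℤ.+ δ k l ℤ.+ δ k k   ≡⟨ cong₂ ℤ._+_ (cong₂ ℤ._+_ (cong₂ ℤ._+_ (δ-self l)
                                                                                     (δ-other (k≢l ∘ sym)))
                                                                       (δ-other k≢l))
                                                       (δ-self k) ⟩
    + 2 ℤ.* + 1                           ≡⟨ cong (+ 2 ℤ.*_) (embed-lastIx (hole k l)) ⟨
    + 2 ℤ.* embed (hole k l) (lastIx {d}) ∎)
  where
  open ≡.≡-Reasoning
  terms : ∀ {c x₁ x₂ x₃ x₄} →
          a d l l c ≡ x₁ → a d l k c ≡ x₂ → a d k l c ≡ x₃ → a d k k c ≡ x₄ →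
          blockSum d k l c ≡ x₁ ℤ.+ x₂ ℤ.+ x₃ ℤ.+ x₄
  terms e₁ e₂ e₃ e₄ = cong₂ ℤ._+_ (cong₂ ℤ._+_ (cong₂ ℤ._+_ e₁ e₂) e₃) e₄
  alternating : ∀ x y → y ℤ.+ x ℤ.+ y ℤ.+ x ≡ + 2 ℤ.* (x ℤ.+ y)
  alternating = solve-∀
  grouped : ∀ x y → y ℤ.+ y ℤ.+ x ℤ.+ x ≡ + 2 ℤ.* (x ℤ.+ y)
  grouped = solve-∀
  on-pair : ∀ m → δ k m ℤ.+ δ l m ≡ + (𝟙 k m + 𝟙 l m)
  on-pair m = trans (cong₂ ℤ._+_ (sym (+𝟙≡δ k m)) (sym (+𝟙≡δ l m))) (sym (ℤ.pos-+ (𝟙 k m) (𝟙 l m)))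

isHkl⇔hole : ∀ {d} {k l : Fin d} {h : Vec d} → k ≢ l → IsHkl d k l h ⇔ h ≗ embed (hole k l)
isHkl⇔hole {d} {k} {l} {h} k≢l = mk⇔
  (λ 2h≡ c → ℤ.*-cancelˡ-≡ (+ 2) (h c) _ (trans (2h≡ c) (blockSum≡2·hole k≢l c)))
  (λ h≗ c → trans (cong (+ 2 ℤ.*_) (h≗ c)) (sym (blockSum≡2·hole k≢l c)))

*-nonneg : ∀ {p q} → 0ℚ ℚ.≤ p → 0ℚ ℚ.≤ q → 0ℚ ℚ.≤ p ℚ.* q
*-nonneg {p} {q} 0≤p 0≤q =
  ℚ.nonNegative⁻¹ (p ℚ.* q) {{ℚ.nonNeg*nonNeg⇒nonNeg p {{ℚ.nonNegative 0≤p}} q {{ℚ.nonNegative 0≤q}}}}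

𝟙-nonneg : ∀ {n} (i j : Fin n) → 0ℚ ℚ.≤ ℚΣ.𝟙 i j
𝟙-nonneg i j with i Fin.≟ j
... | yes _ = *≤* (ℤ.+≤+ z≤n)
... | no  _ = ℚ.≤-refl

module _ where
  open import Data.Rational.Solver using (module +-*-Solver)
  open +-*-Solver

  half-double : ∀ q → ½ ℚ.* (q ℚ.+ q) ≡ q
  half-double = solve 1 (λ q → con ½ :* (q :+ q) := q) refl

  pull-column : ∀ w p q g → (w ℚ.* (p ℚ.* q)) ℚ.* g ≡ ((w ℚ.* p) ℚ.* g) ℚ.* q
  pull-column = solve 4 (λ w p q g → (w :* (p :* q)) :* g := ((w :* p) :* g) :* q) refl

  pull-row : ∀ w p g₁ g₂ →
             (w ℚ.* p) ℚ.* g₁ ℚ.+ (w ℚ.* p) ℚ.* g₂ ≡ (w ℚ.* (g₁ ℚ.+ g₂)) ℚ.* p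
  pull-row = solve 4 (λ w p g₁ g₂ → (w :* p) :* g₁ :+ (w :* p) :* g₂ := (w :* (g₁ :+ g₂)) :* p) refl

  regroup : ∀ w g₁ g₂ g₃ g₄ →
            w ℚ.* (g₄ ℚ.+ g₃ ℚ.+ g₂ ℚ.+ g₁) ≡ w ℚ.* (g₁ ℚ.+ g₂) ℚ.+ w ℚ.* (g₃ ℚ.+ g₄)
  regroup = solve 5 (λ w g₁ g₂ g₃ g₄ → w :* (g₄ :+ g₃ :+ g₂ :+ g₁)
                                      := w :* (g₁ :+ g₂) :+ w :* (g₃ :+ g₄)) refl

-- The weights are ½ on the block {k, l}², so that Σ yᵢⱼ aᵢⱼ = ½ blockSum = h.
isHkl⇒qsat : ∀ {d} {k l : Fin d} {h : Vec d} → IsHkl d k l h → InQsat d h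
isHkl⇒qsat {d} {k} {l} {h} 2h≡ =
  y , y≥0 , λ c → trans (toℚh≡ c) (sym (double-sumℚ≡sum (λ i j → y i j ℚ.* toℚ (a d i j c))))
  where
  open ≡.≡-Reasoning
  P : Fin d → ℚ
  P i = ℚΣ.𝟙 i k ℚ.+ ℚΣ.𝟙 i l
  y : Fin d → Fin d → ℚ
  y i j = ½ ℚ.* (P i ℚ.* P j)
  y≥0 : ∀ i j → 0ℚ ℚ.≤ y i j
  y≥0 i j = *-nonneg {½} (*≤* (ℤ.+≤+ z≤n)) (*-nonneg (P≥0 i) (P≥0 j))
    where
    P≥0 : ∀ i → 0ℚ ℚ.≤ P i
    P≥0 i = ℚ.+-mono-≤ (𝟙-nonneg i k) (𝟙-nonneg i l)
  doubling : ∀ z → z ℤ.+ z ≡ + 2 ℤ.* z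
  doubling = solve-∀
  toℚh≡ : ∀ c → toℚ (h c) ≡ ℚΣ.sum (λ i → ℚΣ.sum (λ j → y i j ℚ.* toℚ (a d i j c)))
  toℚh≡ c = begin
    toℚ (h c)                                            ≡⟨ half-double (toℚ (h c)) ⟨
    ½ ℚ.* (toℚ (h c) ℚ.+ toℚ (h c))                      ≡⟨ cong (½ ℚ.*_) (toℚ-+ (h c) (h c)) ⟨
    ½ ℚ.* toℚ (h c ℤ.+ h c)                              ≡⟨ cong (λ z → ½ ℚ.* toℚ z)
                                                                 (trans (doubling (h c)) (2h≡ c)) ⟩
    ½ ℚ.* toℚ (blockSum d k l c)                         ≡⟨ cong (½ ℚ.*_) toℚ-blockSum ⟩
    ½ ℚ.* (g l l ℚ.+ g l k ℚ.+ g k l ℚ.+ g k k)          ≡⟨ regroup ½ (g k k) (g k l) (g l k) (g l l) ⟩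
    ½ ℚ.* (g k k ℚ.+ g k l) ℚ.+ ½ ℚ.* (g l k ℚ.+ g l l)  ≡⟨ ℚΣ.sum-*𝟙-pair
                                                                 (λ i → ½ ℚ.* (g i k ℚ.+ g i l)) k l ⟨
    ℚΣ.sum (λ i → (½ ℚ.* (g i k ℚ.+ g i l)) ℚ.* P i)     ≡⟨ ℚΣ.sum-cong-≗ inner ⟩
    ℚΣ.sum (λ i → ℚΣ.sum (λ j → y i j ℚ.* g i j))        ∎
    where
    g : Fin d → Fin d → ℚ
    g i j = toℚ (a d i j c)
    toℚ-blockSum : toℚ (blockSum d k l c) ≡ g l l ℚ.+ g l k ℚ.+ g k l ℚ.+ g k k
    toℚ-blockSum =
      trans (toℚ-+ (a d l l c ℤ.+ a d l k c ℤ.+ a d k l c) (a d k k c)) (cong (ℚ._+ g k k)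
        (trans (toℚ-+ (a d l l c ℤ.+ a d l k c) (a d k l c)) (cong (ℚ._+ g k l)
          (toℚ-+ (a d l l c) (a d l k c)))))
    inner : ∀ i → (½ ℚ.* (g i k ℚ.+ g i l)) ℚ.* P i ≡ ℚΣ.sum (λ j → y i j ℚ.* g i j)
    inner i = begin
      (½ ℚ.* (g i k ℚ.+ g i l)) ℚ.* P i
        ≡⟨ pull-row ½ (P i) (g i k) (g i l) ⟨
      (½ ℚ.* P i) ℚ.* g i k ℚ.+ (½ ℚ.* P i) ℚ.* g i l
        ≡⟨ ℚΣ.sum-*𝟙-pair (λ j → (½ ℚ.* P i) ℚ.* g i j) k l ⟨
      ℚΣ.sum (λ j → ((½ ℚ.* P i) ℚ.* g i j) ℚ.* P j)
        ≡⟨ ℚΣ.sum-cong-≗ (λ j → pull-column ½ (P i) (P j) (g i j)) ⟨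
      ℚΣ.sum (λ j → y i j ℚ.* g i j) ∎

hole-isHole : ∀ {d} {k l : Fin d} → k ≢ l → IsHole d (embed (hole k l))
hole-isHole {d} {k} {l} k≢l =
  isHkl⇒qsat {d} {k} {l} (Equivalence.from (isHkl⇔hole k≢l) (λ _ → refl)) ,
  λ inQ → let x , hole≗x = inQ⇒margins inQ in hole-unrealizable k≢l x (embed-injective (λ c → sym (hole≗x c)))

isHole-resp-≗ : {u w : Vec d} → u ≗ w → IsHole d u → IsHole d w
isHole-resp-≗ u≗w ((y , y≥0 , u≡) , u∉Q) =
  (y , y≥0 , λ c → trans (cong toℚ (sym (u≗w c))) (u≡ c)) ,
  λ (x , w≡) → u∉Q (x , λ c → trans (u≗w c) (w≡ c))

-- Fundamental holes

hole-decomposition : {v : Vec d} → IsHole d v →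
                     Σ (Fin d) λ k → Σ (Fin d) λ l → k ≢ l ×
                     Σ (Matrix d) λ x → v ≗ embed (marginsOf x ⊕ hole k l)
hole-decomposition (v∈Qsat , v∉Q) with qsat⇒admissible v∈Qsat
... | μ , v≗μ , adm with decompose μ adm
...   | decomposition _ no-hole x μ≋ =
  ⊥-elim (v∉Q (margins⇒inQ x (λ c → trans (v≗μ c) (embed-≋ (≋-trans μ≋ (⊕-𝟘 (marginsOf x))) c))))
...   | decomposition _ (one-hole k≢l) x μ≋ = _ , _ , k≢l , x , λ c → trans (v≗μ c) (embed-≋ μ≋ c)

hole-inF : ∀ {d} {k l : Fin d} {h : Vec d} → k ≢ l → h ≗ embed (hole k l) → InF d h
hole-inF {d} {k} {l} k≢l h≗hole with <-cmp k l
... | tri< k<l _ _ = k , l , k<l , Equivalence.from (isHkl⇔hole k≢l) h≗hole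
... | tri≈ _ k≡l _ = contradiction k≡l k≢l
... | tri> _ _ l<k = l , k , l<k , Equivalence.from (isHkl⇔hole (k≢l ∘ sym))
                                     (λ c → trans (h≗hole c) (embed-≋ (hole-sym k l) c))

fundamental⇒InF : {h : Vec d} → IsFundamental d h → InF d h
fundamental⇒InF {d} {h} (h-hole , no-other) with hole-decomposition h-hole
... | k , l , k≢l , x , h≗ =
  hole-inF k≢l (λ c → sym (decidable-stable (all? (λ c → embed (hole k l) c ℤ.≟ h c)) not-other c))
  where
  not-other : ¬ ¬ Eq d (embed (hole k l)) h
  not-other ≢h =
    no-other (embed (hole k l) , hole-isHole k≢l , ≢h , margins⇒inQ x (sub-embed-⊕ {μ = marginsOf x} h≗))

InF⇒fundamental : {h : Vec d} → InF d h → IsFundamental d h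
InF⇒fundamental {d} {h} (k , l , k<l , h-isHkl) = isHole-resp-≗ (sym ∘ h≗hole) (hole-isHole k≢l) , no-other
  where
  k≢l : k ≢ l
  k≢l = <⇒≢ k<l
  h≗hole : h ≗ embed (hole k l)
  h≗hole = Equivalence.to (isHkl⇔hole k≢l) h-isHkl
  no-other : ¬ Σ (Vec d) λ h′ → IsHole d h′ × ¬ Eq d h′ h × InQ d (sub d h h′)
  no-other (h′ , h′-hole , h′≢h , difference∈Q) with hole-decomposition h′-hole | inQ⇒margins difference∈Q
  ... | k′ , l′ , _ , x′ , h′≗ | x , difference≗ =
    h′≢h λ c → sym (ℤ.i-j≡0⇒i≡j (h c) (h′ c)
                     (trans (difference≗ c) (trans (embed-≋ x≋𝟘 c) (embed-𝟘 {d} c))))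
    where
    x≋𝟘 : marginsOf x ≋ 𝟘
    x≋𝟘 = hole-minimal {k = k} {l} {μ = marginsOf x′} {k′} {l′} x
            (embed-injective λ c →
              trans (sym (h≗hole c)) (embed-⊕-sub {u = h} {μ = marginsOf x} difference≗ h′≗ c))

mainTheorem3 : (d : ℕ) → d ≥ 1 → (h : Vec d) → IsFundamental d h ⇔ InF d h
mainTheorem3 d _ h = mk⇔ fundamental⇒InF InF⇒fundamental
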